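{- Let $\mathfrak{F}$ be any set of finite simple bipartite graphs. Let $C(\mathfrak{F})$ denote the set of all graphs $G \in \mathfrak{F}$ such that $G$ is connected, has minimum degree at least $2$, and has at least $4$ vertices in each of the two parts of its bipartition. Let $M(\mathfrak{F})$ denote the set of all graphs of the form $G - v$, where $G \in \mathfrak{F}$ and $v \in V(G)$. If every graph in $M(\mathfrak{F})$ and every graph in $C(\mathfrak{F})$ is interval colorable, then every graph in $\mathfrak{F}$ is interval colorable.
   Context: All graphs are finite, undirected, without loops or multiple edges. For a proper edge-coloring $\alpha$ of a graph $G$ and $v \in V(G)$, $S(v,\alpha)$ denotes the set of colors of edges incident to $v$ (the empty set counts as an interval). A proper edge-coloring of $G$ with colors $1,\ldots,t$ is an interval $t$-coloring if every color $1,\ldots,t$ is used and, for every vertex $v$, $S(v,\alpha)$ is an interval of integers. $G$ is interval colorable if it has an interval $t$-coloring for some positive integer $t$. -}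

module Defs where

open import Data.Nat using (ℕ; zero; suc; _≤_; _+_)
open import Data.Bool using (Bool; true; false; if_then_else_)
open import Data.Fin using (Fin; punchIn)
open import Data.List using (List; map; allFin)
open import Data.Nat.ListAction using (sum)
open import Data.Product using (Σ; ∃; ∃-syntax; _×_; _,_)
open import Relation.Binary.PropositionalEquality using (_≡_; _≢_)
open import Relation.Binary.Construct.Closure.ReflexiveTransitive using (Star)

record Graph (n : ℕ) : Set where
  field
    adj    : Fin n → Fin n → Bool
    sym    : ∀ u v → adj u v ≡ adj v u
    irrefl : ∀ v → adj v v ≡ false

open Graph public

Adj : ∀ {n} → Graph n → Fin n → Fin n → Set
Adj G u v = adj G u v ≡ true

count : ∀ {n} → (Fin n → Bool) → ℕ
count {n} p = sum (map (λ u → if p u then 1 else 0) (allFin n))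

degree : ∀ {n} → Graph n → Fin n → ℕ
degree G v = count (adj G v)

MinDegreeAtLeast : ∀ {n} → ℕ → Graph n → Set
MinDegreeAtLeast k G = ∀ v → k ≤ degree G v

Connected : ∀ {n} → Graph n → Set
Connected G = ∀ u v → Star (Adj G) u v

IsBipartition : ∀ {n} → Graph n → (Fin n → Bool) → Set
IsBipartition G side = ∀ u v → Adj G u v → side u ≢ side v

Bipartite : ∀ {n} → Graph n → Set
Bipartite G = ∃[ side ] IsBipartition G side

BothPartsAtLeast4 : ∀ {n} → Graph n → Set
BothPartsAtLeast4 G = ∃[ side ] (IsBipartition G side
                        × 4 ≤ count side
                        × 4 ≤ count (λ u → if side u then false else true))

deleteVertex : ∀ {m} → Graph (suc m) → Fin (suc m) → Graph m
deleteVertex G v = record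
  { adj    = λ u w → adj G (punchIn v u) (punchIn v w)
  ; sym    = λ u w → sym G (punchIn v u) (punchIn v w)
  ; irrefl = λ u → irrefl G (punchIn v u)
  }

-- An edge-colouring is a function c : Fin n → Fin n → ℕ, of which only the
-- values on edges matter.  Interval t-colouring:
record IsIntervalColoring {n} (G : Graph n) (t : ℕ) (c : Fin n → Fin n → ℕ) : Set where
  field
    symmetric : ∀ u v → Adj G u v → c u v ≡ c v u
    inRange   : ∀ u v → Adj G u v → 1 ≤ c u v × c u v ≤ t
    proper    : ∀ v u w → Adj G v u → Adj G v w → c v u ≡ c v w → u ≡ w
    allUsed   : ∀ k → 1 ≤ k → k ≤ t → ∃[ u ] ∃[ v ] (Adj G u v × c u v ≡ k)
    interval  : ∀ v u w k → Adj G v u → Adj G v w → c v u ≤ k → k ≤ c v w →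
                ∃[ x ] (Adj G v x × c v x ≡ k)

IntervalColorable : ∀ {n} → Graph n → Set
IntervalColorable {n} G =
  ∃[ t ] (1 ≤ t × ∃[ c ] IsIntervalColoring G t c)

module Submission where

-- A G ∈ 𝔉 outside
-- that core class
--   * has a vertex v of degree ≤ 1: colour G - v and give the edge at v a
--     colour one above all colours at its neighbour (`low-degree`);
--   * or is disconnected: colour the component of a vertex x as in G - w, for
--     some w outside it, and everything else as in G - x (`disconnected`);
--   * or has a side of at most 3 vertices and is coloured explicitly by a
--     "staircase" layout, up to renaming the three vertices (`small-part`).
-- These constructions only give local interval colourings (proper, and an
-- interval of colours at each vertex); `normalise` then shifts every
-- component to start at colour 1, which gives an interval colouring.

open import Defs hiding (sym)
open import Data.Nat using (ℕ; zero; suc; _+_; _∸_; _⊓_; _⊔_; _≤_; _<_; z≤n; s≤s; _≤?_; _<?_; _≟_)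
open import Data.Nat.Properties
open import Data.Nat.Tactic.RingSolver using (solve)
open import Data.Nat.ListAction using (sum)
open import Data.Bool using (Bool; true; false; if_then_else_; _∨_; _∧_; not)
open import Data.Bool.Properties using (¬-not) renaming (_≟_ to _≟B_)
open import Data.Fin using (Fin; zero; suc; punchIn; punchOut) renaming (_≟_ to _≟F_)
open import Data.Fin.Properties using (any?; all?; ¬∀⟶∃¬; punchIn-punchOut; punchOut-punchIn; punchOut-cong; punchInᵢ≢i)
open import Data.List using (tabulate; _∷_; [])
open import Data.List.Properties using (map-tabulate)
open import Data.Maybe using (Maybe; just; nothing; fromMaybe)
open import Data.Maybe.Properties using (just-injective)
open import Data.Product using (Σ; ∃-syntax; _×_; _,_; proj₁; proj₂)
open import Data.Sum using (_⊎_; inj₁; inj₂)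
open import Data.Empty using (⊥-elim)
open import Function using (_∘_; id)
open import Relation.Binary.PropositionalEquality
open ≡-Reasoning
open import Relation.Binary.Construct.Closure.ReflexiveTransitive using (Star; ε; _◅_; _◅◅_; reverse)
open import Relation.Nullary using (¬_; Dec; yes; no)
open import Relation.Nullary.Decidable using (⌊_⌋; _×-dec_)

true≢false : ¬ true ≡ false
true≢false ()

indicator : Bool → ℕ
indicator true  = 1
indicator false = 0

cnt : ∀ {n} → (Fin n → Bool) → ℕ
cnt {zero}  p = 0
cnt {suc n} p = indicator (p zero) + cnt (p ∘ suc)

rank : ∀ {n} → (Fin n → Bool) → Fin n → ℕ
rank p zero    = 0
rank p (suc y) = indicator (p zero) + rank (p ∘ suc) y

count≡cnt : ∀ {n} (p : Fin n → Bool) → count p ≡ cnt p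
count≡cnt {n} p = trans (cong sum (map-tabulate id f)) (sum-tabulate p)
  where
  f : Fin n → ℕ
  f u = if p u then 1 else 0
  sum-tabulate : ∀ {k} (q : Fin k → Bool) →
                 sum (tabulate (λ u → if q u then 1 else 0)) ≡ cnt q
  sum-tabulate {zero}  q = refl
  sum-tabulate {suc k} q with q zero
  ... | true  = cong suc (sum-tabulate (q ∘ suc))
  ... | false = sum-tabulate (q ∘ suc)

rank<cnt : ∀ {n} (p : Fin n → Bool) y → p y ≡ true → rank p y < cnt p
rank<cnt p zero    py rewrite py = s≤s z≤n
rank<cnt p (suc y) py = +-monoʳ-< (indicator (p zero)) (rank<cnt (p ∘ suc) y py)

rank-injective : ∀ {n} (p : Fin n → Bool) y y' → p y ≡ true → p y' ≡ true →
                 rank p y ≡ rank p y' → y ≡ y'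
rank-injective p zero    zero     _  _   _ = refl
rank-injective p zero    (suc y') py _   r rewrite py = ⊥-elim (0≢1+n r)
rank-injective p (suc y) zero     _  py' r rewrite py' = ⊥-elim (0≢1+n (sym r))
rank-injective p (suc y) (suc y') py py' r =
  cong suc (rank-injective (p ∘ suc) y y' py py' (+-cancelˡ-≡ (indicator (p zero)) _ _ r))

rank-surjective : ∀ {n} (p : Fin n → Bool) j → j < cnt p →
                  ∃[ y ] (p y ≡ true × rank p y ≡ j)
rank-surjective {suc n} p j lt with p zero in p0
rank-surjective {suc n} p zero    lt       | true = zero , p0 , refl
rank-surjective {suc n} p (suc j) (s≤s lt) | true with rank-surjective (p ∘ suc) j lt
... | y , py , r = suc y , py , trans (cong (λ b → indicator b + rank (p ∘ suc) y) p0) (cong suc r)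
rank-surjective {suc n} p j lt | false with rank-surjective (p ∘ suc) j lt
... | y , py , r = suc y , py , trans (cong (λ b → indicator b + rank (p ∘ suc) y) p0) r

cnt≤n : ∀ {n} (p : Fin n → Bool) → cnt p ≤ n
cnt≤n {zero}  p = z≤n
cnt≤n {suc n} p with p zero
... | true  = s≤s (cnt≤n (p ∘ suc))
... | false = m≤n⇒m≤1+n (cnt≤n (p ∘ suc))

cnt-mono : ∀ {n} (p q : Fin n → Bool) → (∀ i → p i ≡ true → q i ≡ true) → cnt p ≤ cnt q
cnt-mono {zero}  p q p⊆q = z≤n
cnt-mono {suc n} p q p⊆q with p zero in p0 | q zero in q0
... | true  | true  = s≤s (cnt-mono (p ∘ suc) (q ∘ suc) (p⊆q ∘ suc))
... | true  | false = ⊥-elim (true≢false (trans (sym (p⊆q zero p0)) q0))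
... | false | true  = m≤n⇒m≤1+n (cnt-mono (p ∘ suc) (q ∘ suc) (p⊆q ∘ suc))
... | false | false = cnt-mono (p ∘ suc) (q ∘ suc) (p⊆q ∘ suc)

cnt-strict : ∀ {n} (p q : Fin n → Bool) → (∀ i → p i ≡ true → q i ≡ true) →
             ∀ j → q j ≡ true → p j ≡ false → cnt p < cnt q
cnt-strict {suc n} p q p⊆q zero    qj pj rewrite qj | pj = s≤s (cnt-mono (p ∘ suc) (q ∘ suc) (p⊆q ∘ suc))
cnt-strict {suc n} p q p⊆q (suc j) qj pj with p zero in p0 | q zero in q0
... | true  | true  = s≤s (cnt-strict (p ∘ suc) (q ∘ suc) (p⊆q ∘ suc) j qj pj)
... | true  | false = ⊥-elim (true≢false (trans (sym (p⊆q zero p0)) q0))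
... | false | true  = m≤n⇒m≤1+n (cnt-strict (p ∘ suc) (q ∘ suc) (p⊆q ∘ suc) j qj pj)
... | false | false = cnt-strict (p ∘ suc) (q ∘ suc) (p⊆q ∘ suc) j qj pj

cnt≤1⇒unique : ∀ {n} (p : Fin n → Bool) y y' → cnt p ≤ 1 → p y ≡ true → p y' ≡ true → y ≡ y'
cnt≤1⇒unique p y y' le py py' =
  rank-injective p y y' py py' (trans (rank≡0 y py) (sym (rank≡0 y' py')))
  where
  rank≡0 : ∀ z → p z ≡ true → rank p z ≡ 0
  rank≡0 z pz = n<1⇒n≡0 (≤-trans (rank<cnt p z pz) le)

2≤cnt⇒two : ∀ {n} (p : Fin n → Bool) → 2 ≤ cnt p →
            ∃[ y ] ∃[ y' ] (p y ≡ true × p y' ≡ true × ¬ y ≡ y')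
2≤cnt⇒two p le with rank-surjective p 0 (≤-trans (s≤s z≤n) le) | rank-surjective p 1 le
... | y , py , r | y' , py' , r' = y , y' , py , py' , λ y≡y' → 0≢1+n (trans (sym r) (trans (cong (rank p) y≡y') r'))

adj-sym : ∀ {n} (G : Graph n) {x y} → Adj G x y → Adj G y x
adj-sym G {x} {y} a = trans (Graph.sym G y x) a

Reach : ∀ {n} → Graph n → Fin n → Fin n → Set
Reach G = Star (Adj G)

reach-sym : ∀ {n} (G : Graph n) {x y} → Reach G x y → Reach G y x
reach-sym G = reverse (adj-sym G)

-- The component of x is computed as a set S
-- containing x, all of whose members are reachable from x, and which is
-- closed under adjacency; such a set is grown one vertex at a time, which
-- terminates since S cannot get larger than the vertex set.
module Component {n} (G : Graph n) (x : Fin n) where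

  Sound : (Fin n → Bool) → Set
  Sound S = S x ≡ true × (∀ z → S z ≡ true → Reach G x z)

  Closed : (Fin n → Bool) → Set
  Closed S = ∀ y z → S y ≡ true → Adj G y z → S z ≡ true

  insert : (Fin n → Bool) → Fin n → Fin n → Bool
  insert S z w = S w ∨ ⌊ w ≟F z ⌋

  insert-old : ∀ S z w → S w ≡ true → insert S z w ≡ true
  insert-old S z w Sw rewrite Sw = refl

  insert-new : ∀ S z → insert S z z ≡ true
  insert-new S z with S z
  ... | true = refl
  ... | false with z ≟F z
  ... | yes _ = refl
  ... | no z≢z = ⊥-elim (z≢z refl)

  insert-inv : ∀ S z w → insert S z w ≡ true → S w ≡ true ⊎ w ≡ z
  insert-inv S z w e with S w
  ... | true = inj₁ refl
  ... | false with w ≟F z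
  ... | yes w≡z = inj₂ w≡z
  ... | no _ = ⊥-elim (true≢false (sym e))

  -- Either S is closed, or some edge leaves S and S can be enlarged;
  -- `fuel` bounds the number of remaining enlargements.
  grow : ∀ fuel (S : Fin n → Bool) → Sound S → n < cnt S + fuel →
         Σ (Fin n → Bool) (λ S' → Sound S' × Closed S')
  grow fuel S sound bound
    with any? (λ y → any? (λ z → (S y ≟B true) ×-dec ((adj G y z ≟B true) ×-dec (S z ≟B false))))
  ... | no no-exit = S , sound , closed
    where
    closed : Closed S
    closed y z Sy a with S z in Sz
    ... | true = refl
    ... | false = ⊥-elim (no-exit (y , z , Sy , a , Sz))
  grow zero S sound bound | yes _ =
    ⊥-elim (<⇒≱ bound (≤-trans (≤-reflexive (+-identityʳ (cnt S))) (cnt≤n S)))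
  grow (suc fuel) S (Sx , reach) bound | yes (y , z , Sy , a , Sz) =
    grow fuel (insert S z) (insert-old S z x Sx , reach') bound'
    where
    reach' : ∀ w → insert S z w ≡ true → Reach G x w
    reach' w e with insert-inv S z w e
    ... | inj₁ Sw = reach w Sw
    ... | inj₂ refl = reach y Sy ◅◅ (a ◅ ε)
    bound' : n < cnt (insert S z) + fuel
    bound' = ≤-trans bound (≤-trans (≤-reflexive (+-suc (cnt S) fuel))
               (+-monoˡ-≤ fuel (cnt-strict S (insert S z) (insert-old S z) z (insert-new S z) Sz)))

  singleton : Fin n → Bool
  singleton w = ⌊ w ≟F x ⌋

  singleton-sound : Sound singleton
  singleton-sound = insert-new (λ _ → false) x , reach
    where
    reach : ∀ z → singleton z ≡ true → Reach G x z
    reach z e with z ≟F x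
    ... | yes refl = ε
    ... | no _ = ⊥-elim (true≢false (sym e))

  component : Σ (Fin n → Bool) (λ S → Sound S × Closed S)
  component = grow (suc n) singleton singleton-sound
                (≤-trans (s≤s (m≤n+m n (cnt singleton))) (≤-reflexive (sym (+-suc (cnt singleton) n))))

-- z is reachable from x iff it lies in the closed set grown from x.
reach? : ∀ {n} (G : Graph n) x z → Dec (Reach G x z)
reach? G x z with Component.component G x
... | S , (Sx , reach) , closed with S z in Sz
... | true = yes (reach z Sz)
... | false = no (λ r → true≢false (trans (sym (stays r Sx)) Sz))
  where
  stays : ∀ {a b} → Reach G a b → S a ≡ true → S b ≡ true
  stays ε Sa = Sa
  stays (e ◅ r) Sa = stays r (closed _ _ Sa e)

-- `sameComponent G x z` decides whether z lies in the component of x.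
-- It is kept abstract so that the type checker never unfolds the search.
abstract
  sameComponent : ∀ {n} (G : Graph n) → Fin n → Fin n → Bool
  sameComponent G x z = ⌊ reach? G x z ⌋

  sameComponent-complete : ∀ {n} (G : Graph n) {x z} → Reach G x z → sameComponent G x z ≡ true
  sameComponent-complete G {x} {z} r with reach? G x z
  ... | yes _ = refl
  ... | no ¬r = ⊥-elim (¬r r)

  sameComponent-sound : ∀ {n} (G : Graph n) {x z} → sameComponent G x z ≡ true → Reach G x z
  sameComponent-sound G {x} {z} e with reach? G x z
  ... | yes r = r
  ... | no _ = ⊥-elim (true≢false (sym e))

  sameComponent-cong : ∀ {n} (G : Graph n) {x y} → Reach G x y → ∀ z → sameComponent G x z ≡ sameComponent G y z
  sameComponent-cong G {x} {y} r z with reach? G x z | reach? G y z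
  ... | yes _ | yes _ = refl
  ... | no _  | no _  = refl
  ... | yes x~z | no ¬y~z = ⊥-elim (¬y~z (reach-sym G r ◅◅ x~z))
  ... | no ¬x~z | yes y~z = ⊥-elim (¬x~z (r ◅◅ y~z))

  sameComponent-step : ∀ {n} (G : Graph n) x {y z} → Adj G y z → sameComponent G x y ≡ sameComponent G x z
  sameComponent-step G x {y} {z} yz with reach? G x y | reach? G x z
  ... | yes _ | yes _ = refl
  ... | no _  | no _  = refl
  ... | yes x~y | no ¬x~z = ⊥-elim (¬x~z (x~y ◅◅ (yz ◅ ε)))
  ... | no ¬x~y | yes x~z = ⊥-elim (¬x~y (x~z ◅◅ (adj-sym G yz ◅ ε)))

-- The extremum, with respect to a selective operation `op` (below: _⊓_ or
-- _⊔_), of the defined values of a partial function on Fin n.  The relation R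
-- expresses "is at least as extreme as".
module Extremum (op : ℕ → ℕ → ℕ) (selective : ∀ a b → op a b ≡ a ⊎ op a b ≡ b)
                (R : ℕ → ℕ → Set) (R-left : ∀ a b → R (op a b) a) (R-right : ∀ a b → R (op a b) b)
                (R-trans : ∀ {a b c} → R a b → R b c → R a c) (R-refl : ∀ a → R a a) where

  combine : Maybe ℕ → Maybe ℕ → Maybe ℕ
  combine nothing  m        = m
  combine (just a) nothing  = just a
  combine (just a) (just b) = just (op a b)

  extremum : ∀ {n} → (Fin n → Maybe ℕ) → Maybe ℕ
  extremum {zero}  f = nothing
  extremum {suc n} f = combine (f zero) (extremum (f ∘ suc))

  extremum-cong : ∀ {n} (f g : Fin n → Maybe ℕ) → (∀ i → f i ≡ g i) → extremum f ≡ extremum g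
  extremum-cong {zero}  f g f≗g = refl
  extremum-cong {suc n} f g f≗g = cong₂ combine (f≗g zero) (extremum-cong (f ∘ suc) (g ∘ suc) (f≗g ∘ suc))

  extremum-defined : ∀ {n} (f : Fin n → Maybe ℕ) i a → f i ≡ just a → ∃[ b ] (extremum f ≡ just b)
  extremum-defined {suc n} f zero a fi with f zero | extremum (f ∘ suc)
  ... | just x | nothing = x , refl
  ... | just x | just y  = op x y , refl
  extremum-defined {suc n} f (suc i) a fi with f zero | extremum-defined (f ∘ suc) i a fi
  ... | nothing | b , eb = b , eb
  ... | just x  | b , eb rewrite eb = op x b , refl

  extremum-bound : ∀ {n} (f : Fin n → Maybe ℕ) i a b → extremum f ≡ just b → f i ≡ just a → R b a
  extremum-bound {suc n} f zero a b eb fi with f zero | extremum (f ∘ suc)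
  extremum-bound {suc n} f zero a b refl refl | just x | nothing = R-refl x
  extremum-bound {suc n} f zero a b refl refl | just x | just y  = R-left x y
  extremum-bound {suc n} f (suc i) a b eb fi with extremum-defined (f ∘ suc) i a fi
  ... | b' , eb' with f zero | extremum-bound (f ∘ suc) i a b' eb' fi
  ... | nothing | r rewrite eb' = subst (λ z → R z a) (just-injective eb) r
  ... | just x  | r rewrite eb' = subst (λ z → R z a) (just-injective eb) (R-trans (R-right x b') r)

  extremum-attained : ∀ {n} (f : Fin n → Maybe ℕ) b → extremum f ≡ just b → ∃[ i ] (f i ≡ just b)
  extremum-attained {suc n} f b eb with f zero in f0
  ... | nothing with extremum-attained (f ∘ suc) b eb
  ... | i , fi = suc i , fi
  extremum-attained {suc n} f b eb | just x with extremum (f ∘ suc) in rest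
  ... | nothing = zero , trans f0 (cong just (just-injective eb))
  ... | just y with selective x y
  ... | inj₁ sel = zero , trans f0 (cong just (trans (sym sel) (just-injective eb)))
  ... | inj₂ sel with extremum-attained (f ∘ suc) y rest
  ... | i , fi = suc i , trans fi (cong just (trans (sym sel) (just-injective eb)))

open Extremum _⊓_ ⊓-sel _≤_ m⊓n≤m m⊓n≤n ≤-trans (λ _ → ≤-refl) using () renaming
  (extremum to minimum; extremum-cong to minimum-cong; extremum-defined to minimum-defined;
   extremum-bound to minimum-bound; extremum-attained to minimum-attained)
open Extremum _⊔_ ⊔-sel (λ a b → b ≤ a) m≤m⊔n m≤n⊔m (λ p q → ≤-trans q p) (λ _ → ≤-refl) using () renaming
  (extremum to maximum; extremum-defined to maximum-defined;
   extremum-bound to maximum-bound; extremum-attained to maximum-attained)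

guard : Bool → Maybe ℕ → Maybe ℕ
guard true  m = m
guard false m = nothing

guard-true : ∀ {b} m → b ≡ true → guard b m ≡ m
guard-true m refl = refl

guard-just : ∀ b m {y} → guard b m ≡ just y → b ≡ true × m ≡ just y
guard-just true m e = refl , e

-- This drops the
-- global requirements (range 1..t, every colour used) of an interval colouring.
record LocalAt {n} (G : Graph n) (c : Fin n → Fin n → ℕ) (v : Fin n) : Set where
  field
    symmetric : ∀ u → Adj G v u → c v u ≡ c u v
    positive  : ∀ u → Adj G v u → 1 ≤ c v u
    proper    : ∀ u w → Adj G v u → Adj G v w → c v u ≡ c v w → u ≡ w
    interval  : ∀ u w k → Adj G v u → Adj G v w → c v u ≤ k → k ≤ c v w →
                ∃[ x ] (Adj G v x × c v x ≡ k)

Local : ∀ {n} → Graph n → (Fin n → Fin n → ℕ) → Set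
Local G c = ∀ v → LocalAt G c v

interval⇒local : ∀ {n} {G : Graph n} {t c} → IsIntervalColoring G t c → Local G c
interval⇒local IC v = record
  { symmetric = symmetric v
  ; positive  = λ u a → proj₁ (inRange v u a)
  ; proper    = proper v
  ; interval  = interval v
  }
  where open IsIntervalColoring IC

localAt-cong : ∀ {n} {G : Graph n} {c c' : Fin n → Fin n → ℕ} {v} →
               (∀ u → Adj G v u → c v u ≡ c' v u × c u v ≡ c' u v) → LocalAt G c' v → LocalAt G c v
localAt-cong {G = G} {c} {c'} {v} agree L' = record
  { symmetric = λ u a → trans (here u a) (trans (symmetric u a) (sym (proj₂ (agree u a))))
  ; positive  = λ u a → subst (1 ≤_) (sym (here u a)) (positive u a)
  ; proper    = λ u w a b e → proper u w a b (trans (sym (here u a)) (trans e (here w b)))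
  ; interval  = intv
  }
  where
  open LocalAt L'
  here : ∀ u → Adj G v u → c v u ≡ c' v u
  here u a = proj₁ (agree u a)
  intv : ∀ u w k → Adj G v u → Adj G v w → c v u ≤ k → k ≤ c v w → ∃[ x ] (Adj G v x × c v x ≡ k)
  intv u w k a b lo hi with interval u w k a b (subst (_≤ k) (here u a) lo) (subst (k ≤_) (here w b) hi)
  ... | x , ax , cx = x , ax , trans (here x ax) cx

-- In a local interval colouring the colours used within a connected piece of
-- the graph form an interval: walk along a path, stepping through the
-- interval at each vertex.
colours-connected : ∀ {n} {G : Graph n} {c} → Local G c →
  ∀ {a b} → Reach G a b → ∀ a' b' k → Adj G a a' → Adj G b b' → c a a' ≤ k → k ≤ c b b' →
  ∃[ x ] ∃[ y ] (Adj G x y × c x y ≡ k)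
colours-connected L ε a' b' k aa' bb' lo hi with LocalAt.interval (L _) a' b' k aa' bb' lo hi
... | x , ax , cx = _ , x , ax , cx
colours-connected {c = c} L {a} (_◅_ {j = a₁} aa₁ path) a' b' k aa' bb' lo hi with k ≤? c a a₁
... | yes k≤ with LocalAt.interval (L a) a' a₁ k aa' aa₁ lo k≤
... | x , ax , cx = a , x , ax , cx
colours-connected {G = G} {c} L {a} (_◅_ {j = a₁} aa₁ path) a' b' k aa' bb' lo hi | no k≰ =
  colours-connected L path a b' k (adj-sym G aa₁) bb'
    (≤-trans (≤-reflexive (sym (LocalAt.symmetric (L a) a₁ aa₁))) (<⇒≤ (≰⇒> k≰))) hi

-- Normalisation: shifting the colours of every component so that its least
-- colour becomes 1 turns a local interval colouring of a graph with at least
-- one edge into an interval colouring.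
module Normalise {n} (G : Graph n) (c : Fin n → Fin n → ℕ) (L : Local G c) where

  leastAt : Fin n → Maybe ℕ
  leastAt u = minimum (λ v → guard (adj G u v) (just (c u v)))

  leastIn : Fin n → Maybe ℕ
  leastIn x = minimum (λ u → guard (sameComponent G x u) (leastAt u))

  shift : Fin n → ℕ
  shift x = fromMaybe 1 (leastIn x)

  leastIn-below : ∀ x u v → sameComponent G x u ≡ true → Adj G u v → ∃[ b ] (leastIn x ≡ just b × b ≤ c u v)
  leastIn-below x u v xu uv
    with minimum-defined (λ v → guard (adj G u v) (just (c u v))) v (c u v) (guard-true _ uv)
  ... | b₁ , e₁ with minimum-defined (λ u → guard (sameComponent G x u) (leastAt u)) u b₁ (trans (guard-true _ xu) e₁)
  ... | b₂ , e₂ = b₂ , e₂ , ≤-trans (minimum-bound _ u b₁ b₂ e₂ (trans (guard-true _ xu) e₁))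
                                     (minimum-bound _ v (c u v) b₁ e₁ (guard-true _ uv))

  leastIn-attained : ∀ x b → leastIn x ≡ just b → ∃[ u ] ∃[ v ] (sameComponent G x u ≡ true × Adj G u v × c u v ≡ b)
  leastIn-attained x b e with minimum-attained _ b e
  ... | u , eu with sameComponent G x u in xu
  ... | false = ⊥-elim (nothing≢just eu)
    where nothing≢just : ¬ (nothing ≡ just b)
          nothing≢just ()
  ... | true with minimum-attained _ b eu
  ... | v , ev with guard-just (adj G u v) _ ev
  ... | uv , cuv = u , v , xu , uv , just-injective cuv

  shift≤ : ∀ u v → Adj G u v → shift u ≤ c u v
  shift≤ u v uv with leastIn-below u u v (sameComponent-complete G ε) uv
  ... | b , e , le rewrite e = le

  shift-cong : ∀ u w → Reach G u w → shift u ≡ shift w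
  shift-cong u w r = cong (fromMaybe 1) (minimum-cong _ _ (λ z → cong (λ b → guard b (leastAt z)) (sameComponent-cong G r z)))

  normalised : Fin n → Fin n → ℕ
  normalised u v = suc (c u v ∸ shift u)

  normalised-local : Local G normalised
  normalised-local v = record
    { symmetric = λ u a → cong suc (cong₂ _∸_ (symmetric u a) (shift-cong v u (a ◅ ε)))
    ; positive  = λ u a → s≤s z≤n
    ; proper    = λ u w a b e → proper u w a b (∸-cancelʳ-≡ (shift≤ v u a) (shift≤ v w b) (suc-injective e))
    ; interval  = intv
    }
    where
    open LocalAt (L v)
    intv : ∀ u w k → Adj G v u → Adj G v w → normalised v u ≤ k → k ≤ normalised v w →
           ∃[ x ] (Adj G v x × normalised v x ≡ k)
    intv u w (suc k) a b (s≤s lo) (s≤s hi)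
      with interval u w (k + shift v) a b
             (≤-trans (≤-reflexive (sym (m∸n+n≡m (shift≤ v u a)))) (+-monoˡ-≤ (shift v) lo))
             (≤-trans (+-monoˡ-≤ (shift v) hi) (≤-reflexive (m∸n+n≡m (shift≤ v w b))))
    ... | x , ax , cx = x , ax , cong suc (trans (cong (_∸ shift v) cx) (m+n∸n≡m k (shift v)))

  greatestAt : Fin n → Maybe ℕ
  greatestAt u = maximum (λ v → guard (adj G u v) (just (normalised u v)))

  greatest : Maybe ℕ
  greatest = maximum greatestAt

  below-greatest : ∀ t → greatest ≡ just t → ∀ u v → Adj G u v → normalised u v ≤ t
  below-greatest t et u v uv with maximum-defined (λ v → guard (adj G u v) (just (normalised u v))) v _ (guard-true _ uv)
  ... | b , eb = ≤-trans (maximum-bound _ v _ b eb (guard-true _ uv)) (maximum-bound _ u b t et eb)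

  -- ... every component uses the colour 1 ...
  one-used : ∀ u v → Adj G u v → ∃[ u₁ ] ∃[ v₁ ] (Reach G u u₁ × Adj G u₁ v₁ × normalised u₁ v₁ ≡ 1)
  one-used u v uv with leastIn-below u u v (sameComponent-complete G ε) uv
  ... | b , eb , _ with leastIn-attained u b eb
  ... | u₁ , v₁ , uu₁ , u₁v₁ , cb = u₁ , v₁ , sameComponent-sound G uu₁ , u₁v₁ ,
    cong suc (trans (cong (c u₁ v₁ ∸_) (sym (shift-cong u u₁ (sameComponent-sound G uu₁))))
             (trans (cong (λ m → c u₁ v₁ ∸ fromMaybe 1 m) eb) (trans (cong (_∸ b) cb) (n∸n≡0 b))))

  -- ... so, as colours within a component form an interval, all of 1..t are used
  interval-colourable : ∀ u v → Adj G u v → IntervalColorable G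
  interval-colourable u₀ v₀ a₀
    with maximum-defined (λ v → guard (adj G u₀ v) (just (normalised u₀ v))) v₀ _ (guard-true _ a₀)
  ... | b , eb with maximum-defined greatestAt u₀ b eb
  ... | t , et = t , ≤-trans (s≤s z≤n) (below-greatest t et u₀ v₀ a₀) , normalised , record
    { symmetric = λ u v a → LocalAt.symmetric (normalised-local u) v a
    ; inRange   = λ u v a → s≤s z≤n , below-greatest t et u v a
    ; proper    = λ v → LocalAt.proper (normalised-local v)
    ; allUsed   = used
    ; interval  = λ v → LocalAt.interval (normalised-local v)
    }
    where
    used : ∀ k → 1 ≤ k → k ≤ t → ∃[ u ] ∃[ v ] (Adj G u v × normalised u v ≡ k)
    used k lo hi with maximum-attained greatestAt t et
    ... | um , eum with maximum-attained _ t eum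
    ... | vm , evm with guard-just (adj G um vm) _ evm
    ... | am , cm with one-used um vm am
    ... | u₁ , v₁ , r , a₁ , c₁ =
      colours-connected normalised-local (reach-sym G r) v₁ vm k a₁ am
        (≤-trans (≤-reflexive c₁) lo) (≤-trans hi (≤-reflexive (sym (just-injective cm))))

normalise : ∀ {n} {G : Graph n} {c} → Local G c → ∀ {u v} → Adj G u v → IntervalColorable G
normalise {G = G} {c} L {u} {v} = Normalise.interval-colourable G c L u v

-- A colouring of G - v is viewed as a colouring of G in which the edges at v
-- get colour 0.  It is a local interval colouring at every vertex of G that
-- is not adjacent to v.
module Deletion {m} (G : Graph (suc m)) (v : Fin (suc m)) where

  unpunch : Fin (suc m) → Maybe (Fin m)
  unpunch x with v ≟F x
  ... | yes _   = nothing
  ... | no v≢x  = just (punchOut v≢x)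

  unpunch-punchIn : ∀ a → unpunch (punchIn v a) ≡ just a
  unpunch-punchIn a with v ≟F punchIn v a
  ... | yes v≡ = ⊥-elim (punchInᵢ≢i v a (sym v≡))
  ... | no _   = cong just (trans (punchOut-cong v refl) (punchOut-punchIn v))

  preimage : ∀ x → ¬ x ≡ v → ∃[ a ] (punchIn v a ≡ x)
  preimage x x≢v with v ≟F x
  ... | yes v≡x  = ⊥-elim (x≢v (sym v≡x))
  ... | no v≢x   = punchOut v≢x , punchIn-punchOut v≢x

  lift : (Fin m → Fin m → ℕ) → Fin (suc m) → Fin (suc m) → ℕ
  lift c₀ x y = apply (unpunch x) (unpunch y)
    where
    apply : Maybe (Fin m) → Maybe (Fin m) → ℕ
    apply (just a) (just b) = c₀ a b
    apply _        _        = 0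

  lift-punchIn : ∀ c₀ a b → lift c₀ (punchIn v a) (punchIn v b) ≡ c₀ a b
  lift-punchIn c₀ a b rewrite unpunch-punchIn a | unpunch-punchIn b = refl

  module _ {c₀ : Fin m → Fin m → ℕ} (a : Fin m) (L : LocalAt (deleteVertex G v) c₀ a) where
    open LocalAt L
    private
      x = punchIn v a

    lift-symmetric : ∀ u → Adj G x u → ¬ u ≡ v → lift c₀ x u ≡ lift c₀ u x
    lift-symmetric u au u≢v with preimage u u≢v
    ... | b , refl = trans (lift-punchIn c₀ a b) (trans (symmetric b au) (sym (lift-punchIn c₀ b a)))

    lift-positive : ∀ u → Adj G x u → ¬ u ≡ v → 1 ≤ lift c₀ x u
    lift-positive u au u≢v with preimage u u≢v
    ... | b , refl = subst (1 ≤_) (sym (lift-punchIn c₀ a b)) (positive b au)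

    lift-proper : ∀ u w → Adj G x u → Adj G x w → ¬ u ≡ v → ¬ w ≡ v → lift c₀ x u ≡ lift c₀ x w → u ≡ w
    lift-proper u w au aw u≢v w≢v e with preimage u u≢v | preimage w w≢v
    ... | b , refl | b' , refl =
      cong (punchIn v) (proper b b' au aw (trans (sym (lift-punchIn c₀ a b)) (trans e (lift-punchIn c₀ a b'))))

    lift-interval : ∀ u w k → Adj G x u → Adj G x w → ¬ u ≡ v → ¬ w ≡ v →
                    lift c₀ x u ≤ k → k ≤ lift c₀ x w → ∃[ y ] (Adj G x y × ¬ y ≡ v × lift c₀ x y ≡ k)
    lift-interval u w k au aw u≢v w≢v lo hi with preimage u u≢v | preimage w w≢v
    ... | b , refl | b' , refl
      with interval b b' k au aw (subst (_≤ k) (lift-punchIn c₀ a b) lo) (subst (k ≤_) (lift-punchIn c₀ a b') hi)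
    ... | y , ay , cy = punchIn v y , ay , punchInᵢ≢i v y , trans (lift-punchIn c₀ a y) cy

    lift-localAt : ¬ Adj G x v → LocalAt G (lift c₀) x
    lift-localAt ¬xv = record
      { symmetric = λ u au → lift-symmetric u au (avoid au)
      ; positive  = λ u au → lift-positive u au (avoid au)
      ; proper    = λ u w au aw → lift-proper u w au aw (avoid au) (avoid aw)
      ; interval  = λ u w k au aw lo hi →
          let (y , ay , _ , cy) = lift-interval u w k au aw (avoid au) (avoid aw) lo hi in y , ay , cy
      }
      where
      avoid : ∀ {u} → Adj G x u → ¬ u ≡ v
      avoid xu refl = ¬xv xu

  lift-local : ∀ {c₀} → Local (deleteVertex G v) c₀ → ∀ x → ¬ x ≡ v → ¬ Adj G x v → LocalAt G (lift c₀) x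
  lift-local L x x≢v ¬xv with preimage x x≢v
  ... | a , refl = lift-localAt a (L a) ¬xv

  some-edge : IntervalColorable (deleteVertex G v) → ∃[ x ] ∃[ y ] (Adj G x y × ¬ x ≡ v × ¬ y ≡ v)
  some-edge (t , 1≤t , c₀ , IC) with IsIntervalColoring.allUsed IC 1 ≤-refl 1≤t
  ... | a , b , ab , _ = punchIn v a , punchIn v b , ab , punchInᵢ≢i v a , punchInᵢ≢i v b

isolatedAt : ∀ {n} {G : Graph n} {c} {v} → (∀ u → ¬ Adj G v u) → LocalAt G c v
isolatedAt iso = record
  { symmetric = λ u a → ⊥-elim (iso u a)
  ; positive  = λ u a → ⊥-elim (iso u a)
  ; proper    = λ u w a _ _ → ⊥-elim (iso u a)
  ; interval  = λ u w k a _ _ _ → ⊥-elim (iso u a)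
  }

pendantAt : ∀ {n} {G : Graph n} {c : Fin n → Fin n → ℕ} {v w} → (∀ u → Adj G v u → u ≡ w) → Adj G v w →
            c v w ≡ c w v → 1 ≤ c v w → LocalAt G c v
pendantAt {G = G} {c} {v} {w} only vw sym-vw pos-vw = record
  { symmetric = λ u a → subst (λ z → c v z ≡ c z v) (sym (only u a)) sym-vw
  ; positive  = λ u a → subst (λ z → 1 ≤ c v z) (sym (only u a)) pos-vw
  ; proper    = λ u u' a a' _ → trans (only u a) (sym (only u' a'))
  ; interval  = intv
  }
  where
  intv : ∀ u u' k → Adj G v u → Adj G v u' → c v u ≤ k → k ≤ c v u' → ∃[ x ] (Adj G v x × c v x ≡ k)
  intv u u' k a a' lo hi with only u a | only u' a'
  ... | refl | refl = u , a , ≤-antisym lo hi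

-- Adding back a vertex v of degree at most one to an interval colouring of
-- G - v: an isolated v changes nothing; a pendant edge vw gets a colour one
-- larger than all colours at w.
module LowDegree {m} (G : Graph (suc m)) (v : Fin (suc m))
                 {c₀ : Fin m → Fin m → ℕ} (L₀ : Local (deleteVertex G v) c₀) where
  open Deletion G v

  isolated : (∀ u → ¬ Adj G v u) → Local G (lift c₀)
  isolated iso x with x ≟F v
  ... | yes refl = isolatedAt iso
  ... | no x≢v   = lift-local L₀ x x≢v (λ xv → iso x (adj-sym G xv))

  module Pendant (w : Fin (suc m)) (vw : Adj G v w) (only : ∀ u → Adj G v u → u ≡ w) where

    w≢v : ¬ w ≡ v
    w≢v refl = true≢false (trans (sym vw) (Graph.irrefl G v))

    old : Fin (suc m) → Maybe ℕ
    old u = guard (adj G w u ∧ not ⌊ u ≟F v ⌋) (just (lift c₀ w u))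

    old-defined : ∀ u → Adj G w u → ¬ u ≡ v → old u ≡ just (lift c₀ w u)
    old-defined u wu u≢v with u ≟F v
    ... | yes u≡v = ⊥-elim (u≢v u≡v)
    ... | no _ rewrite wu = refl

    old-neighbour : ∀ u {b} → old u ≡ just b → Adj G w u × ¬ u ≡ v × lift c₀ w u ≡ b
    old-neighbour u e with adj G w u in wu | u ≟F v
    ... | true | no u≢v = refl , u≢v , just-injective e

    new : ℕ
    new = suc (fromMaybe 0 (maximum old))

    old<new : ∀ u → Adj G w u → ¬ u ≡ v → lift c₀ w u < new
    old<new u wu u≢v with maximum-defined old u _ (old-defined u wu u≢v)
    ... | b , eb rewrite eb = s≤s (maximum-bound old u _ b eb (old-defined u wu u≢v))

    old-top : ∀ k → k < new → ∀ u → Adj G w u → ¬ u ≡ v → ∃[ u' ] (Adj G w u' × ¬ u' ≡ v × k ≤ lift c₀ w u')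
    old-top k k<new u wu u≢v with maximum-defined old u _ (old-defined u wu u≢v)
    ... | b , eb with maximum-attained old b eb
    ... | u' , eu' with old-neighbour u' eu'
    ... | wu' , u'≢v , cu' rewrite eb = u' , wu' , u'≢v , ≤-trans (≤-pred k<new) (≤-reflexive (sym cu'))

    -- deciding u ≡ v by a test that `colour` does not mention, so that case
    -- splits on it leave goals about `colour` intact
    is-v? : ∀ u → u ≡ v ⊎ ¬ u ≡ v
    is-v? u with u ≟F v
    ... | yes u≡v = inj₁ u≡v
    ... | no u≢v  = inj₂ u≢v

    colour : Fin (suc m) → Fin (suc m) → ℕ
    colour x y with x ≟F v | y ≟F v
    ... | yes _ | _     = new
    ... | no _  | yes _ = new
    ... | no _  | no _  = lift c₀ x y

    colour-from-v : ∀ y → colour v y ≡ new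
    colour-from-v y with v ≟F v
    ... | yes _ = refl
    ... | no v≢v = ⊥-elim (v≢v refl)

    colour-to-v : ∀ x → colour x v ≡ new
    colour-to-v x with x ≟F v | v ≟F v
    ... | yes _ | _      = refl
    ... | no _  | yes _  = refl
    ... | no _  | no v≢v = ⊥-elim (v≢v refl)

    colour-away : ∀ x y → ¬ x ≡ v → ¬ y ≡ v → colour x y ≡ lift c₀ x y
    colour-away x y x≢v y≢v with x ≟F v | y ≟F v
    ... | yes x≡v | _       = ⊥-elim (x≢v x≡v)
    ... | no _    | yes y≡v = ⊥-elim (y≢v y≡v)
    ... | no _    | no _    = refl

    at-w : LocalAt G colour w
    at-w with preimage w w≢v
    ... | a , refl = record { symmetric = symm ; positive = pos ; proper = prop ; interval = intv }
      where
      wa = punchIn v a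
      colour-w : ∀ u → ¬ u ≡ v → colour wa u ≡ lift c₀ wa u
      colour-w u u≢v = colour-away wa u w≢v u≢v
      symm : ∀ u → Adj G wa u → colour wa u ≡ colour u wa
      symm u au with is-v? u
      ... | inj₁ refl = trans (colour-to-v wa) (sym (colour-from-v wa))
      ... | inj₂ u≢v = trans (colour-w u u≢v) (trans (lift-symmetric a (L₀ a) u au u≢v)
                       (sym (colour-away u wa u≢v w≢v)))
      pos : ∀ u → Adj G wa u → 1 ≤ colour wa u
      pos u au with is-v? u
      ... | inj₁ refl = subst (1 ≤_) (sym (colour-to-v wa)) (s≤s z≤n)
      ... | inj₂ u≢v = subst (1 ≤_) (sym (colour-w u u≢v)) (lift-positive a (L₀ a) u au u≢v)
      prop : ∀ u u' → Adj G wa u → Adj G wa u' → colour wa u ≡ colour wa u' → u ≡ u'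
      prop u u' au au' e with is-v? u | is-v? u'
      ... | inj₁ refl | inj₁ refl = refl
      ... | inj₁ refl | inj₂ u'≢v = ⊥-elim (<⇒≢ (old<new u' au' u'≢v)
                                   (sym (trans (sym (colour-to-v wa)) (trans e (colour-w u' u'≢v)))))
      ... | inj₂ u≢v | inj₁ refl = ⊥-elim (<⇒≢ (old<new u au u≢v)
                                   (trans (sym (colour-w u u≢v)) (trans e (colour-to-v wa))))
      ... | inj₂ u≢v | inj₂ u'≢v = lift-proper a (L₀ a) u u' au au' u≢v u'≢v
                                 (trans (sym (colour-w u u≢v)) (trans e (colour-w u' u'≢v)))
      intv : ∀ u u' k → Adj G wa u → Adj G wa u' → colour wa u ≤ k → k ≤ colour wa u' →
             ∃[ x ] (Adj G wa x × colour wa x ≡ k)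
      intv u u' k au au' lo hi with is-v? u | is-v? u'
      ... | inj₁ refl | inj₁ refl = u , au , ≤-antisym lo hi
      ... | inj₁ refl | inj₂ u'≢v = ⊥-elim (<⇒≱ (old<new u' au' u'≢v)
             (≤-trans (≤-reflexive (sym (colour-to-v wa))) (≤-trans lo (≤-trans hi (≤-reflexive (colour-w u' u'≢v))))))
      ... | inj₂ u≢v | inj₁ refl with k ≟ new
      ... | yes k≡new = u' , au' , trans (colour-to-v wa) (sym k≡new)
      ... | no k≢new with old-top k (≤∧≢⇒< (≤-trans hi (≤-reflexive (colour-to-v wa))) k≢new) u au u≢v
      ... | u₂ , au₂ , u₂≢v , k≤ with lift-interval a (L₀ a) u u₂ k au au₂ u≢v u₂≢v
                                      (≤-trans (≤-reflexive (sym (colour-w u u≢v))) lo) k≤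
      ... | x , ax , x≢v , cx = x , ax , trans (colour-w x x≢v) cx
      intv u u' k au au' lo hi | inj₂ u≢v | inj₂ u'≢v
        with lift-interval a (L₀ a) u u' k au au' u≢v u'≢v
               (≤-trans (≤-reflexive (sym (colour-w u u≢v))) lo) (≤-trans hi (≤-reflexive (colour-w u' u'≢v)))
      ... | x , ax , x≢v , cx = x , ax , trans (colour-w x x≢v) cx

    pendant : Local G colour
    pendant x with is-v? x | x ≟F w
    ... | inj₁ refl | _ = pendantAt only vw (trans (colour-from-v w) (sym (colour-to-v w)))
                           (subst (1 ≤_) (sym (colour-from-v w)) (s≤s z≤n))
    ... | inj₂ _ | yes refl = at-w
    ... | inj₂ x≢v | no x≢w = localAt-cong agree (lift-local L₀ x x≢v ¬xv)
      where
      ¬xv : ¬ Adj G x v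
      ¬xv xv = x≢w (only x (adj-sym G xv))
      agree : ∀ u → Adj G x u → colour x u ≡ lift c₀ x u × colour u x ≡ lift c₀ u x
      agree u xu = colour-away x u x≢v u≢v , colour-away u x u≢v x≢v
        where u≢v : ¬ u ≡ v
              u≢v refl = ¬xv xu

  local : degree G v ≤ 1 → ∃[ c ] Local G c
  local deg with any? (λ u → adj G v u ≟B true)
  ... | no none = lift c₀ , isolated (λ u a → none (u , a))
  ... | yes (w , vw) = Pendant.colour w vw only , Pendant.pendant w vw only
    where
    only : ∀ u → Adj G v u → u ≡ w
    only u vu = cnt≤1⇒unique (adj G v) u w (≤-trans (≤-reflexive (sym (count≡cnt (adj G v)))) deg) vu vw

low-degree : ∀ {m} (G : Graph (suc m)) v → degree G v ≤ 1 → IntervalColorable (deleteVertex G v) → IntervalColorable G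
low-degree G v deg col@(_ , _ , _ , IC) with LowDegree.local G v (interval⇒local IC) deg | Deletion.some-edge G v col
... | c , L | x , y , xy , _ = normalise L xy

module Disconnected {m} (G : Graph (suc m)) {x w : Fin (suc m)} (x↛w : ¬ Reach G x w)
                    {c₁ : Fin m → Fin m → ℕ} (L₁ : Local (deleteVertex G w) c₁)
                    {c₂ : Fin m → Fin m → ℕ} (L₂ : Local (deleteVertex G x) c₂) where

  inside : Fin (suc m) → Bool
  inside = sameComponent G x

  colour : Fin (suc m) → Fin (suc m) → ℕ
  colour y z = if inside y then Deletion.lift G w c₁ y z else Deletion.lift G x c₂ y z

  colour-inside : ∀ {y} z → inside y ≡ true → colour y z ≡ Deletion.lift G w c₁ y z
  colour-inside z e rewrite e = refl

  colour-outside : ∀ {y} z → inside y ≡ false → colour y z ≡ Deletion.lift G x c₂ y z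
  colour-outside z e rewrite e = refl

  agree-inside : ∀ {y} → inside y ≡ true → ∀ z → Adj G y z →
                 colour y z ≡ Deletion.lift G w c₁ y z × colour z y ≡ Deletion.lift G w c₁ z y
  agree-inside e z yz = colour-inside z e , colour-inside _ (trans (sym (sameComponent-step G x yz)) e)

  agree-outside : ∀ {y} → inside y ≡ false → ∀ z → Adj G y z →
                  colour y z ≡ Deletion.lift G x c₂ y z × colour z y ≡ Deletion.lift G x c₂ z y
  agree-outside e z yz = colour-outside z e , colour-outside _ (trans (sym (sameComponent-step G x yz)) e)

  local : Local G colour
  local y with inside y in e
  ... | true  = localAt-cong (agree-inside e) (Deletion.lift-local G w L₁ y y≢w ¬yw)
    where
    x~y : Reach G x y
    x~y = sameComponent-sound G e
    y≢w : ¬ y ≡ w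
    y≢w refl = x↛w x~y
    ¬yw : ¬ Adj G y w
    ¬yw yw = x↛w (x~y ◅◅ (yw ◅ ε))
  ... | false = localAt-cong (agree-outside e) (Deletion.lift-local G x L₂ y y≢x ¬yx)
    where
    x↛y : ¬ Reach G x y
    x↛y r = true≢false (trans (sym (sameComponent-complete G r)) e)
    y≢x : ¬ y ≡ x
    y≢x refl = x↛y ε
    ¬yx : ¬ Adj G y x
    ¬yx yx = x↛y (adj-sym G yx ◅ ε)

disconnected : ∀ {m} (G : Graph (suc m)) → (∀ v → IntervalColorable (deleteVertex G v)) →
               ∀ {x w} → ¬ Reach G x w → IntervalColorable G
disconnected G del {x} {w} x↛w with del w | del x
... | col₁@(_ , _ , _ , IC₁) | (_ , _ , _ , IC₂) with Deletion.some-edge G w col₁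
... | y , z , yz , _ = normalise (Disconnected.local G x↛w (interval⇒local IC₁) (interval⇒local IC₂)) yz

-- The three vertices of the small side play the roles H, A and B; a vertex
-- of the other side, adjacent to at least two of them, has one of the four
-- kinds HA, HB, AB, HAB (the set of roles of its neighbours).
Role : Set
Role = Fin 3

pattern H = zero
pattern A = suc zero
pattern B = suc (suc zero)

Kind : Set
Kind = Fin 4

pattern HA  = zero
pattern HB  = suc zero
pattern AB  = suc (suc zero)
pattern HAB = suc (suc (suc zero))

member : Kind → Role → Bool
member HA  B = false
member HB  A = false
member AB  H = false
member _   _ = true

-- Given the number N τ of vertices of each kind, the items (τ , j) with
-- j < N τ and role i in τ are the neighbours of role i.
Valid : (Kind → ℕ) → Kind → Role → ℕ → Set
Valid N τ i j = member τ i ≡ true × j < N τ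

-- A layout for the counts N: an interval colouring of the "model" bipartite
-- graph with the three roles on one side, N τ vertices (τ , j) of each kind
-- τ on the other, and (τ , j) adjacent to the roles in τ.
record Layout (N : Kind → ℕ) : Set where
  field
    colour         : Kind → Role → ℕ → ℕ
    positive       : ∀ {τ i j} → Valid N τ i j → 1 ≤ colour τ i j
    role-injective : ∀ {i τ j τ' j'} → Valid N τ i j → Valid N τ' i j' →
                     colour τ i j ≡ colour τ' i j' → (τ , j) ≡ (τ' , j')
    role-interval  : ∀ {i τ j τ' j' k} → Valid N τ i j → Valid N τ' i j' →
                     colour τ i j ≤ k → k ≤ colour τ' i j' → ∃[ τ'' ] ∃[ j'' ] (Valid N τ'' i j'' × colour τ'' i j'' ≡ k)
    kind-injective : ∀ {τ i i' j} → member τ i ≡ true → member τ i' ≡ true →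
                     colour τ i j ≡ colour τ i' j → i ≡ i'
    kind-interval  : ∀ {τ i i' j k} → member τ i ≡ true → member τ i' ≡ true →
                     colour τ i j ≤ k → k ≤ colour τ i' j → ∃[ i'' ] (member τ i'' ≡ true × colour τ i'' j ≡ k)

record Symmetry : Set where
  field
    σ        : Role → Role
    σ̂        : Kind → Kind
    σ-invol  : ∀ i → σ (σ i) ≡ i
    σ̂-invol  : ∀ τ → σ̂ (σ̂ τ) ≡ τ
    member-σ : ∀ τ i → member (σ̂ τ) (σ i) ≡ member τ i

relabel : (S : Symmetry) {N N' : Kind → ℕ} → (∀ τ → N' (Symmetry.σ̂ S τ) ≡ N τ) → Layout N' → Layout N
relabel S {N} {N'} N'σ̂≡N L = record
  { colour         = colour
  ; positive       = λ v → L.positive (valid v)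
  ; role-injective = λ v v' e → unrename (L.role-injective (valid v) (valid v') e)
  ; role-interval  = role-interval
  ; kind-injective = λ {τ} m m' e → trans (sym (σ-invol _))
                       (trans (cong σ (L.kind-injective (member-to τ m) (member-to τ m') e)) (σ-invol _))
  ; kind-interval  = kind-interval
  }
  where
  open Symmetry S
  module L = Layout L

  colour : Kind → Role → ℕ → ℕ
  colour τ i j = L.colour (σ̂ τ) (σ i) j

  member-to : ∀ τ {i} → member τ i ≡ true → member (σ̂ τ) (σ i) ≡ true
  member-to τ {i} m = trans (member-σ τ i) m

  valid : ∀ {τ i j} → Valid N τ i j → Valid N' (σ̂ τ) (σ i) j
  valid {τ} (m , lt) = member-to τ m , subst (_ <_) (sym (N'σ̂≡N τ)) lt

  unrename : ∀ {τ j τ' j'} → (σ̂ τ , j) ≡ (σ̂ τ' , j') → (τ , j) ≡ (τ' , j')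
  unrename {τ} {τ' = τ'} e = cong₂ _,_ (trans (sym (σ̂-invol τ)) (trans (cong (σ̂ ∘ proj₁) e) (σ̂-invol τ'))) (cong proj₂ e)

  role-interval : ∀ {i τ j τ' j' k} → Valid N τ i j → Valid N τ' i j' →
                  colour τ i j ≤ k → k ≤ colour τ' i j' → ∃[ τ'' ] ∃[ j'' ] (Valid N τ'' i j'' × colour τ'' i j'' ≡ k)
  role-interval {i} v v' lo hi with L.role-interval (valid v) (valid v') lo hi
  ... | κ , j'' , (m , lt) , e =
    σ̂ κ , j'' , (trans (sym (member-σ (σ̂ κ) i)) (trans (cong (λ τ → member τ (σ i)) (σ̂-invol κ)) m) ,
                 subst (j'' <_) (trans (cong N' (sym (σ̂-invol κ))) (N'σ̂≡N (σ̂ κ))) lt) ,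
    trans (cong (λ τ → L.colour τ (σ i) j'') (σ̂-invol κ)) e

  kind-interval : ∀ {τ i i' j k} → member τ i ≡ true → member τ i' ≡ true →
                  colour τ i j ≤ k → k ≤ colour τ i' j → ∃[ i'' ] (member τ i'' ≡ true × colour τ i'' j ≡ k)
  kind-interval {τ} {j = j} m m' lo hi with L.kind-interval (member-to τ m) (member-to τ m') lo hi
  ... | ι , mι , e = σ ι , trans (sym (member-σ τ (σ ι))) (trans (cong (member (σ̂ τ)) (σ-invol ι)) mι) ,
                     trans (cong (λ i → L.colour (σ̂ τ) i j) (σ-invol ι)) e

identity : Symmetry
identity = record { σ = λ i → i ; σ̂ = λ τ → τ ; σ-invol = λ _ → refl ; σ̂-invol = λ _ → refl ; member-σ = λ _ _ → refl }

swap-HA : Symmetry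
swap-HA = record { σ = σ ; σ̂ = σ̂ ; σ-invol = σ-invol ; σ̂-invol = σ̂-invol ; member-σ = member-σ }
  where
  σ : Role → Role
  σ H = A
  σ A = H
  σ B = B
  σ̂ : Kind → Kind
  σ̂ HA = HA
  σ̂ HB = AB
  σ̂ AB = HB
  σ̂ HAB = HAB
  σ-invol : ∀ i → σ (σ i) ≡ i
  σ-invol H = refl
  σ-invol A = refl
  σ-invol B = refl
  σ̂-invol : ∀ τ → σ̂ (σ̂ τ) ≡ τ
  σ̂-invol HA = refl
  σ̂-invol HB = refl
  σ̂-invol AB = refl
  σ̂-invol HAB = refl
  member-σ : ∀ τ i → member (σ̂ τ) (σ i) ≡ member τ i
  member-σ HA H = refl
  member-σ HA A = refl
  member-σ HA B = refl
  member-σ HB H = refl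
  member-σ HB A = refl
  member-σ HB B = refl
  member-σ AB H = refl
  member-σ AB A = refl
  member-σ AB B = refl
  member-σ HAB _ = refl

swap-HB : Symmetry
swap-HB = record { σ = σ ; σ̂ = σ̂ ; σ-invol = σ-invol ; σ̂-invol = σ̂-invol ; member-σ = member-σ }
  where
  σ : Role → Role
  σ H = B
  σ A = A
  σ B = H
  σ̂ : Kind → Kind
  σ̂ HA = AB
  σ̂ HB = HB
  σ̂ AB = HA
  σ̂ HAB = HAB
  σ-invol : ∀ i → σ (σ i) ≡ i
  σ-invol H = refl
  σ-invol A = refl
  σ-invol B = refl
  σ̂-invol : ∀ τ → σ̂ (σ̂ τ) ≡ τ
  σ̂-invol HA = refl
  σ̂-invol HB = refl
  σ̂-invol AB = refl
  σ̂-invol HAB = refl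
  member-σ : ∀ τ i → member (σ̂ τ) (σ i) ≡ member τ i
  member-σ HA H = refl
  member-σ HA A = refl
  member-σ HA B = refl
  member-σ HB H = refl
  member-σ HB A = refl
  member-σ HB B = refl
  member-σ AB H = refl
  member-σ AB A = refl
  member-σ AB B = refl
  member-σ HAB _ = refl

branch : ∀ {X : Set} → ℕ → (ℕ → X) → (ℕ → X) → ℕ → X
branch ℓ f g d with d <? ℓ
... | yes _ = f d
... | no _  = g (d ∸ ℓ)

branch-below : ∀ {X : Set} ℓ (f g : ℕ → X) {d} → d < ℓ → branch ℓ f g d ≡ f d
branch-below ℓ f g {d} d<ℓ with d <? ℓ
... | yes _ = refl
... | no d≮ℓ = ⊥-elim (d≮ℓ d<ℓ)

branch-above : ∀ {X : Set} ℓ (f g : ℕ → X) e → branch ℓ f g (ℓ + e) ≡ g e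
branch-above ℓ f g e with ℓ + e <? ℓ
... | yes lt = ⊥-elim (<⇒≱ lt (m≤m+n ℓ e))
... | no _ = cong g (m+n∸m≡n ℓ e)

half : ℕ → ℕ × Bool
half zero = 0 , false
half (suc zero) = 0 , true
half (suc (suc d)) with half d
... | j , b = suc j , b

half-even : ∀ j → half (j + j) ≡ (j , false)
half-even zero = refl
half-even (suc j) rewrite +-suc j j | half-even j = refl

half-odd : ∀ j → half (suc (j + j)) ≡ (j , true)
half-odd zero = refl
half-odd (suc j) rewrite +-suc j j | half-odd j = refl

data Parity : ℕ → Set where
  even : ∀ j → Parity (j + j)
  odd  : ∀ j → Parity (suc (j + j))

parity : ∀ d → Parity d
parity zero = even 0
parity (suc zero) = odd 0
parity (suc (suc d)) with parity d
... | even j = subst Parity (cong suc (+-suc j j)) (even (suc j))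
... | odd j  = subst Parity (cong (λ x → suc (suc x)) (+-suc j j)) (odd (suc j))

halve : ∀ {j r} → j + j < r + r → j < r
halve {j} {r} lt with j <? r
... | yes j<r = j<r
... | no j≮r = ⊥-elim (<⇒≱ lt (+-mono-≤ (≮⇒≥ j≮r) (≮⇒≥ j≮r)))

-- A schedule lists, in increasing order of colour, the edges at one vertex:
-- a block of ℓ₁ edges, a block of ℓ₂ edges, r pairs of alternately an
-- "even" and an "odd" edge, and a final block of ℓ₄ edges.  `Slot d` says
-- where position d falls.
module Schedule (ℓ₁ ℓ₂ r ℓ₄ : ℕ) where

  data Slot : ℕ → Set where
    first  : ∀ d → d < ℓ₁ → Slot d
    second : ∀ d → d < ℓ₂ → Slot (ℓ₁ + d)
    even   : ∀ j → j < r  → Slot (ℓ₁ + (ℓ₂ + (j + j)))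
    odd    : ∀ j → j < r  → Slot (ℓ₁ + (ℓ₂ + suc (j + j)))
    last   : ∀ d → d < ℓ₄ → Slot (ℓ₁ + (ℓ₂ + ((r + r) + d)))

  length : ℕ
  length = ℓ₁ + (ℓ₂ + ((r + r) + ℓ₄))

  slot-bound : ∀ {d} → Slot d → d < length
  slot-bound (first d lt)  = ≤-trans lt (m≤m+n ℓ₁ _)
  slot-bound (second d lt) = +-monoʳ-< ℓ₁ (≤-trans lt (m≤m+n ℓ₂ _))
  slot-bound (even j lt)   = +-monoʳ-< ℓ₁ (+-monoʳ-< ℓ₂ (≤-trans (+-mono-< lt lt) (m≤m+n (r + r) ℓ₄)))
  slot-bound (odd j lt)    = +-monoʳ-< ℓ₁ (+-monoʳ-< ℓ₂
                               (≤-trans (≤-trans (≤-reflexive (cong suc (sym (+-suc j j)))) (+-mono-≤ lt lt))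
                                        (m≤m+n (r + r) ℓ₄)))
  slot-bound (last d lt)   = +-monoʳ-< ℓ₁ (+-monoʳ-< ℓ₂ (+-monoʳ-< (r + r) lt))

  slot : ∀ d → d < length → Slot d
  slot d lt with d <? ℓ₁
  ... | yes d<ℓ₁ = first d d<ℓ₁
  ... | no d≮ℓ₁ with m≤n⇒∃[o]m+o≡n (≮⇒≥ d≮ℓ₁)
  ... | e , refl with e <? ℓ₂
  ... | yes e<ℓ₂ = second e e<ℓ₂
  ... | no e≮ℓ₂ with m≤n⇒∃[o]m+o≡n (≮⇒≥ e≮ℓ₂)
  ... | f , refl with f <? r + r
  ... | yes f<2r = in-pairs f f<2r (parity f)
    where
    in-pairs : ∀ f → f < r + r → Parity f → Slot (ℓ₁ + (ℓ₂ + f))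
    in-pairs _ lt (even j) = even j (halve lt)
    in-pairs _ lt (odd j)  = odd j (halve (<-trans (n<1+n (j + j)) lt))
  ... | no f≮2r with m≤n⇒∃[o]m+o≡n (≮⇒≥ f≮2r)
  ... | g , refl = last g (+-cancelˡ-< (r + r) _ _ (+-cancelˡ-< ℓ₂ _ _ (+-cancelˡ-< ℓ₁ _ _ lt)))

  module _ {I : Set} (f₁ f₂ fₑ fₒ f₄ : ℕ → I) where

    item : ∀ {d} → Slot d → I
    item (first d _)  = f₁ d
    item (second d _) = f₂ d
    item (even j _)   = fₑ j
    item (odd j _)    = fₒ j
    item (last d _)   = f₄ d

    pair : ℕ × Bool → I
    pair (j , false) = fₑ j
    pair (j , true)  = fₒ j

    decode : ℕ → I
    decode = branch ℓ₁ f₁ (branch ℓ₂ f₂ (branch (r + r) (pair ∘ half) f₄))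

    decode-item : ∀ {d} (s : Slot d) → decode d ≡ item s
    decode-item (first d lt) = branch-below ℓ₁ f₁ _ lt
    decode-item (second d lt) = trans (branch-above ℓ₁ f₁ _ d) (branch-below ℓ₂ f₂ _ lt)
    decode-item (even j lt) =
      trans (branch-above ℓ₁ f₁ _ _) (trans (branch-above ℓ₂ f₂ _ _)
        (trans (branch-below (r + r) (pair ∘ half) f₄ (+-mono-< lt lt)) (cong pair (half-even j))))
    decode-item (odd j lt) =
      trans (branch-above ℓ₁ f₁ _ _) (trans (branch-above ℓ₂ f₂ _ _)
        (trans (branch-below (r + r) (pair ∘ half) f₄
                  (≤-trans (≤-reflexive (cong suc (sym (+-suc j j)))) (+-mono-≤ lt lt)))
          (cong pair (half-odd j))))
    decode-item (last d lt) =
      trans (branch-above ℓ₁ f₁ _ _) (trans (branch-above ℓ₂ f₂ _ _) (branch-above (r + r) (pair ∘ half) f₄ d))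

    module Colouring (ok : I → Set) (code : I → ℕ) (s₀ : ℕ)
                     (scheduled : ∀ {x} → ok x → ∃[ d ] Σ (Slot d) (λ s → item s ≡ x))
                     (filled : ∀ {d} (s : Slot d) → ok (item s) × code (item s) ≡ s₀ + d) where

      position : ∀ {x} → ok x → ∃[ d ] (Slot d × code x ≡ s₀ + d × decode d ≡ x)
      position okx with scheduled okx
      ... | d , s , refl = d , s , proj₂ (filled s) , decode-item s

      injective : ∀ {x x'} → ok x → ok x' → code x ≡ code x' → x ≡ x'
      injective okx okx' e with position okx | position okx'
      ... | d , _ , cx , dx | d' , _ , cx' , dx' =
        trans (sym dx) (trans (cong decode (+-cancelˡ-≡ s₀ d d' (trans (sym cx) (trans e cx')))) dx')

      interval : ∀ {x x' k} → ok x → ok x' → code x ≤ k → k ≤ code x' → ∃[ x'' ] (ok x'' × code x'' ≡ k)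
      interval {k = k} okx okx' lo hi with position okx | position okx'
      ... | d , _ , cx , _ | d' , s' , cx' , _ with m≤n⇒∃[o]m+o≡n (≤-trans (m≤m+n s₀ d) (subst (_≤ k) cx lo))
      ... | e , refl with filled (slot e (≤-trans (s≤s (+-cancelˡ-≤ s₀ e d' (subst (s₀ + e ≤_) cx' hi))) (slot-bound s')))
      ... | ok-e , ce = _ , ok-e , ce

      positive : 1 ≤ s₀ → ∀ {x} → ok x → 1 ≤ code x
      positive 1≤s₀ okx with position okx
      ... | d , _ , cx , _ = ≤-trans (≤-trans 1≤s₀ (m≤m+n s₀ d)) (≤-reflexive (sym cx))

offset : Kind → Role → ℕ
offset HA  H = 1
offset HB  B = 1
offset AB  B = 1
offset HAB H = 1
offset HAB B = 2
offset _   _ = 0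

width : Kind → ℕ
width HAB = 2
width _   = 1

offset≤width : ∀ τ i → offset τ i ≤ width τ
offset≤width HA  H = ≤-refl
offset≤width HB  B = ≤-refl
offset≤width AB  B = ≤-refl
offset≤width HAB H = s≤s z≤n
offset≤width HAB B = ≤-refl
offset≤width HA  A = z≤n
offset≤width HA  B = z≤n
offset≤width HB  H = z≤n
offset≤width HB  A = z≤n
offset≤width AB  H = z≤n
offset≤width AB  A = z≤n
offset≤width HAB A = z≤n

roleAt : Kind → ℕ → Role
roleAt HA  0 = A
roleAt HA  _ = H
roleAt HB  0 = H
roleAt HB  _ = B
roleAt AB  0 = A
roleAt AB  _ = B
roleAt HAB 0 = A
roleAt HAB 1 = H
roleAt HAB _ = B

roleAt-offset : ∀ τ i → member τ i ≡ true → roleAt τ (offset τ i) ≡ i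
roleAt-offset HA  H _ = refl
roleAt-offset HA  A _ = refl
roleAt-offset HB  H _ = refl
roleAt-offset HB  B _ = refl
roleAt-offset AB  A _ = refl
roleAt-offset AB  B _ = refl
roleAt-offset HAB H _ = refl
roleAt-offset HAB A _ = refl
roleAt-offset HAB B _ = refl
roleAt-offset HA  B ()
roleAt-offset HB  A ()
roleAt-offset AB  H ()

roleAt-member : ∀ τ e → e ≤ width τ → member τ (roleAt τ e) ≡ true × offset τ (roleAt τ e) ≡ e
roleAt-member HA  0 _ = refl , refl
roleAt-member HA  1 _ = refl , refl
roleAt-member HB  0 _ = refl , refl
roleAt-member HB  1 _ = refl , refl
roleAt-member AB  0 _ = refl , refl
roleAt-member AB  1 _ = refl , refl
roleAt-member HAB 0 _ = refl , refl
roleAt-member HAB 1 _ = refl , refl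
roleAt-member HAB 2 _ = refl , refl
roleAt-member HA  (suc (suc _)) (s≤s ())
roleAt-member HB  (suc (suc _)) (s≤s ())
roleAt-member AB  (suc (suc _)) (s≤s ())
roleAt-member HAB (suc (suc (suc _))) (s≤s (s≤s ()))

-- The explicit layout when the kind AB is the rarest.  With N AB = r,
-- N HB = q + r, N HA = r + p, N HAB = c and m = q + c, the colours are
--
--     kind HB,  j < q  :  H 2 + j          B 3 + j
--     kind HAB          :  A q + 1 + j      H q + 2 + j      B q + 3 + j
--     kind HA,  j < r  :  A m + 1 + 2j     H m + 2 + 2j
--     kind AB           :  A m + 2 + 2j     B m + 3 + 2j
--     kind HB,  q + j  :  H m + 3 + 2j     B m + 4 + 2j
--     kind HA,  r + f  :  A m + 1 + 2r + f  H m + 2 + 2r + f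
--
-- so every vertex of the other side sees consecutive colours, H sees
-- 2 .. m + 2r + p + 1, A sees q + 1 .. m + 2r + p and B sees 3 .. m + 2r + 2:
-- the middle part interleaves the kinds HA/HB (at H), HA/AB (at A) and
-- AB/HB (at B), which is where r ≤ N HA and r ≤ N HB are needed.
module Staircase (r q p c : ℕ) where

  size : Kind → ℕ
  size HA  = r + p
  size HB  = q + r
  size AB  = r
  size HAB = c

  base : Kind → ℕ → ℕ
  base HA  = branch r (λ j → q + c + 1 + (j + j)) (λ f → q + c + 1 + (r + r) + f)
  base HB  = branch q (λ j → 2 + j) (λ j → q + c + 3 + (j + j))
  base AB  j = q + c + 2 + (j + j)
  base HAB j = q + 1 + j

  colour : Kind → Role → ℕ → ℕ
  colour τ i j = base τ j + offset τ i

  module ScheduleH = Schedule q c r p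
  module ScheduleA = Schedule 0 c r p
  module ScheduleB = Schedule q c r 0

  itemH : ∀ {d} → ScheduleH.Slot d → Kind × ℕ
  itemH = ScheduleH.item (HB ,_) (HAB ,_) (HA ,_) (λ j → HB , q + j) (λ f → HA , r + f)
  itemA : ∀ {d} → ScheduleA.Slot d → Kind × ℕ
  itemA = ScheduleA.item (HAB ,_) (HAB ,_) (HA ,_) (AB ,_) (λ f → HA , r + f)
  itemB : ∀ {d} → ScheduleB.Slot d → Kind × ℕ
  itemB = ScheduleB.item (HB ,_) (HAB ,_) (AB ,_) (λ j → HB , q + j) (HB ,_)

  Ok : Role → Kind × ℕ → Set
  Ok i (τ , j) = Valid size τ i j

  code : Role → Kind × ℕ → ℕ
  code i (τ , j) = colour τ i j

  scheduledH : ∀ {x} → Ok H x → ∃[ d ] Σ (ScheduleH.Slot d) (λ s → itemH s ≡ x)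
  scheduledH {HA , j} (_ , lt) with j <? r
  ... | yes j<r = _ , ScheduleH.even j j<r , refl
  ... | no j≮r with m≤n⇒∃[o]m+o≡n (≮⇒≥ j≮r)
  ... | f , refl = _ , ScheduleH.last f (+-cancelˡ-< r _ _ lt) , refl
  scheduledH {HB , j} (_ , lt) with j <? q
  ... | yes j<q = _ , ScheduleH.first j j<q , refl
  ... | no j≮q with m≤n⇒∃[o]m+o≡n (≮⇒≥ j≮q)
  ... | f , refl = _ , ScheduleH.odd f (+-cancelˡ-< q _ _ lt) , refl
  scheduledH {HAB , j} (_ , lt) = _ , ScheduleH.second j lt , refl

  filledH : ∀ {d} (s : ScheduleH.Slot d) → Ok H (itemH s) × code H (itemH s) ≡ 2 + d
  filledH (ScheduleH.first d lt) = (refl , ≤-trans lt (m≤m+n q r)) , (begin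
    base HB d + 0          ≡⟨ cong (_+ 0) (branch-below q _ _ lt) ⟩
    2 + d + 0              ≡⟨ +-identityʳ (2 + d) ⟩
    2 + d                  ∎)
  filledH (ScheduleH.second d lt) = (refl , lt) , (begin
    q + 1 + d + 1          ≡⟨ solve (q ∷ d ∷ []) ⟩
    2 + (q + d)            ∎)
  filledH (ScheduleH.even j lt) = (refl , ≤-trans lt (m≤m+n r p)) , (begin
    base HA j + 1                    ≡⟨ cong (_+ 1) (branch-below r _ _ lt) ⟩
    q + c + 1 + (j + j) + 1          ≡⟨ solve (q ∷ c ∷ j ∷ []) ⟩
    2 + (q + (c + (j + j)))          ∎)
  filledH (ScheduleH.odd j lt) = (refl , +-monoʳ-< q lt) , (begin
    base HB (q + j) + 0              ≡⟨ cong (_+ 0) (branch-above q _ _ j) ⟩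
    q + c + 3 + (j + j) + 0          ≡⟨ solve (q ∷ c ∷ j ∷ []) ⟩
    2 + (q + (c + suc (j + j)))      ∎)
  filledH (ScheduleH.last f lt) = (refl , +-monoʳ-< r lt) , (begin
    base HA (r + f) + 1              ≡⟨ cong (_+ 1) (branch-above r _ _ f) ⟩
    q + c + 1 + (r + r) + f + 1      ≡⟨ solve (q ∷ c ∷ r ∷ f ∷ []) ⟩
    2 + (q + (c + ((r + r) + f)))    ∎)

  scheduledA : ∀ {x} → Ok A x → ∃[ d ] Σ (ScheduleA.Slot d) (λ s → itemA s ≡ x)
  scheduledA {HA , j} (_ , lt) with j <? r
  ... | yes j<r = _ , ScheduleA.even j j<r , refl
  ... | no j≮r with m≤n⇒∃[o]m+o≡n (≮⇒≥ j≮r)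
  ... | f , refl = _ , ScheduleA.last f (+-cancelˡ-< r _ _ lt) , refl
  scheduledA {AB , j} (_ , lt) = _ , ScheduleA.odd j lt , refl
  scheduledA {HAB , j} (_ , lt) = _ , ScheduleA.second j lt , refl

  filledA : ∀ {d} (s : ScheduleA.Slot d) → Ok A (itemA s) × code A (itemA s) ≡ q + 1 + d
  filledA (ScheduleA.second d lt) = (refl , lt) , +-identityʳ (q + 1 + d)
  filledA (ScheduleA.even j lt) = (refl , ≤-trans lt (m≤m+n r p)) , (begin
    base HA j + 0                    ≡⟨ cong (_+ 0) (branch-below r _ _ lt) ⟩
    q + c + 1 + (j + j) + 0          ≡⟨ solve (q ∷ c ∷ j ∷ []) ⟩
    q + 1 + (c + (j + j))            ∎)
  filledA (ScheduleA.odd j lt) = (refl , lt) , (begin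
    q + c + 2 + (j + j) + 0          ≡⟨ solve (q ∷ c ∷ j ∷ []) ⟩
    q + 1 + (c + suc (j + j))        ∎)
  filledA (ScheduleA.last f lt) = (refl , +-monoʳ-< r lt) , (begin
    base HA (r + f) + 0              ≡⟨ cong (_+ 0) (branch-above r _ _ f) ⟩
    q + c + 1 + (r + r) + f + 0      ≡⟨ solve (q ∷ c ∷ r ∷ f ∷ []) ⟩
    q + 1 + (c + ((r + r) + f))      ∎)

  scheduledB : ∀ {x} → Ok B x → ∃[ d ] Σ (ScheduleB.Slot d) (λ s → itemB s ≡ x)
  scheduledB {HB , j} (_ , lt) with j <? q
  ... | yes j<q = _ , ScheduleB.first j j<q , refl
  ... | no j≮q with m≤n⇒∃[o]m+o≡n (≮⇒≥ j≮q)
  ... | f , refl = _ , ScheduleB.odd f (+-cancelˡ-< q _ _ lt) , refl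
  scheduledB {AB , j} (_ , lt) = _ , ScheduleB.even j lt , refl
  scheduledB {HAB , j} (_ , lt) = _ , ScheduleB.second j lt , refl

  filledB : ∀ {d} (s : ScheduleB.Slot d) → Ok B (itemB s) × code B (itemB s) ≡ 3 + d
  filledB (ScheduleB.first d lt) = (refl , ≤-trans lt (m≤m+n q r)) , (begin
    base HB d + 1                    ≡⟨ cong (_+ 1) (branch-below q _ _ lt) ⟩
    2 + d + 1                        ≡⟨ solve (d ∷ []) ⟩
    3 + d                            ∎)
  filledB (ScheduleB.second d lt) = (refl , lt) , (begin
    q + 1 + d + 2                    ≡⟨ solve (q ∷ d ∷ []) ⟩
    3 + (q + d)                      ∎)
  filledB (ScheduleB.even j lt) = (refl , lt) , (begin
    q + c + 2 + (j + j) + 1          ≡⟨ solve (q ∷ c ∷ j ∷ []) ⟩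
    3 + (q + (c + (j + j)))          ∎)
  filledB (ScheduleB.odd j lt) = (refl , +-monoʳ-< q lt) , (begin
    base HB (q + j) + 1              ≡⟨ cong (_+ 1) (branch-above q _ _ j) ⟩
    q + c + 3 + (j + j) + 1          ≡⟨ solve (q ∷ c ∷ j ∷ []) ⟩
    3 + (q + (c + suc (j + j)))      ∎)

  module ColouringH = ScheduleH.Colouring (HB ,_) (HAB ,_) (HA ,_) (λ j → HB , q + j) (λ f → HA , r + f)
                        (Ok H) (code H) 2 scheduledH filledH
  module ColouringA = ScheduleA.Colouring (HAB ,_) (HAB ,_) (HA ,_) (AB ,_) (λ f → HA , r + f)
                        (Ok A) (code A) (q + 1) scheduledA filledA
  module ColouringB = ScheduleB.Colouring (HB ,_) (HAB ,_) (AB ,_) (λ j → HB , q + j) (HB ,_)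
                        (Ok B) (code B) 3 scheduledB filledB

  layout : Layout size
  layout = record
    { colour         = colour
    ; positive       = positive
    ; role-injective = role-injective
    ; role-interval  = role-interval
    ; kind-injective = kind-injective
    ; kind-interval  = kind-interval
    }
    where
    positive : ∀ {τ i j} → Valid size τ i j → 1 ≤ colour τ i j
    positive {i = H} = ColouringH.positive (s≤s z≤n)
    positive {i = A} = ColouringA.positive (m≤n+m 1 q)
    positive {i = B} = ColouringB.positive (s≤s z≤n)

    role-injective : ∀ {i τ j τ' j'} → Valid size τ i j → Valid size τ' i j' →
                     colour τ i j ≡ colour τ' i j' → (τ , j) ≡ (τ' , j')
    role-injective {H} = ColouringH.injective
    role-injective {A} = ColouringA.injective
    role-injective {B} = ColouringB.injective

    role-interval : ∀ {i τ j τ' j' k} → Valid size τ i j → Valid size τ' i j' →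
                    colour τ i j ≤ k → k ≤ colour τ' i j' →
                    ∃[ τ'' ] ∃[ j'' ] (Valid size τ'' i j'' × colour τ'' i j'' ≡ k)
    role-interval {H} v v' lo hi with ColouringH.interval v v' lo hi
    ... | (τ'' , j'') , ok , e = τ'' , j'' , ok , e
    role-interval {A} v v' lo hi with ColouringA.interval v v' lo hi
    ... | (τ'' , j'') , ok , e = τ'' , j'' , ok , e
    role-interval {B} v v' lo hi with ColouringB.interval v v' lo hi
    ... | (τ'' , j'') , ok , e = τ'' , j'' , ok , e

    -- within a kind, colours differ by the offsets of the roles
    kind-injective : ∀ {τ i i' j} → member τ i ≡ true → member τ i' ≡ true →
                     colour τ i j ≡ colour τ i' j → i ≡ i'
    kind-injective {τ} {i} {i'} {j} m m' e =
      trans (sym (roleAt-offset τ i m))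
        (trans (cong (roleAt τ) (+-cancelˡ-≡ (base τ j) _ _ e)) (roleAt-offset τ i' m'))

    kind-interval : ∀ {τ i i' j k} → member τ i ≡ true → member τ i' ≡ true →
                    colour τ i j ≤ k → k ≤ colour τ i' j → ∃[ i'' ] (member τ i'' ≡ true × colour τ i'' j ≡ k)
    kind-interval {τ} {i} {i'} {j} m m' lo hi
      with m≤n⇒∃[o]m+o≡n (≤-trans (m≤m+n (base τ j) (offset τ i)) lo)
    ... | e , refl with roleAt-member τ e (≤-trans (+-cancelˡ-≤ (base τ j) e _ hi) (offset≤width τ i'))
    ... | mι , oι = roleAt τ e , mι , cong (base τ j +_) oι

-- A layout exists for all counts: rename the roles so that AB becomes the
-- rarest kind, and use the staircase.
layout-via : (S : Symmetry) (N : Kind → ℕ) → let open Symmetry S in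
             N (σ̂ AB) ≤ N (σ̂ HA) → N (σ̂ AB) ≤ N (σ̂ HB) → Layout N
layout-via S N AB≤HA AB≤HB = relabel S sizes (Staircase.layout r q p c)
  where
  open Symmetry S
  r q p c : ℕ
  r = N (σ̂ AB)
  q = N (σ̂ HB) ∸ r
  p = N (σ̂ HA) ∸ r
  c = N (σ̂ HAB)
  sizes : ∀ τ → Staircase.size r q p c (σ̂ τ) ≡ N τ
  sizes τ = trans (renamed (σ̂ τ)) (cong N (σ̂-invol τ))
    where
    renamed : ∀ κ → Staircase.size r q p c κ ≡ N (σ̂ κ)
    renamed HA  = m+[n∸m]≡n AB≤HA
    renamed HB  = trans (+-comm q r) (m+[n∸m]≡n AB≤HB)
    renamed AB  = refl
    renamed HAB = refl

layout : (N : Kind → ℕ) → Layout N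
layout N with N AB ≤? N HA | N AB ≤? N HB | N HB ≤? N HA
... | yes AB≤HA | yes AB≤HB | _ = layout-via identity N AB≤HA AB≤HB
... | _ | no AB≰HB | yes HB≤HA = layout-via swap-HA N HB≤HA (<⇒≤ (≰⇒> AB≰HB))
... | no AB≰HA | yes AB≤HB | _ = layout-via swap-HB N (<⇒≤ (≰⇒> AB≰HA)) (≤-trans (<⇒≤ (≰⇒> AB≰HA)) AB≤HB)
... | _ | no AB≰HB | no HB≰HA = layout-via swap-HB N (<⇒≤ (<-trans (≰⇒> HB≰HA) (≰⇒> AB≰HB))) (<⇒≤ (≰⇒> HB≰HA))

-- The kind of a vertex seeing the roles b₀ b₁ b₂ (of H, A, B); this is
-- meaningful when at least two roles are seen.
classify : Bool → Bool → Bool → Kind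
classify true  true  false = HA
classify true  false true  = HB
classify false true  true  = AB
classify _     _     _     = HAB

atLeastTwo : Bool → Bool → Bool → Bool
atLeastTwo true  true  _ = true
atLeastTwo true  false c = c
atLeastTwo false b     c = b ∧ c

bits : Bool → Bool → Bool → Role → Bool
bits b₀ b₁ b₂ H = b₀
bits b₀ b₁ b₂ A = b₁
bits b₀ b₁ b₂ B = b₂

member-classify : ∀ b₀ b₁ b₂ → atLeastTwo b₀ b₁ b₂ ≡ true → ∀ i → member (classify b₀ b₁ b₂) i ≡ bits b₀ b₁ b₂ i
member-classify true  true  false _ = λ { H → refl ; A → refl ; B → refl }
member-classify true  false true  _ = λ { H → refl ; A → refl ; B → refl }
member-classify false true  true  _ = λ { H → refl ; A → refl ; B → refl }
member-classify true  true  true  _ = λ { H → refl ; A → refl ; B → refl }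
member-classify true  false false ()
member-classify false true  false ()
member-classify false false true  ()
member-classify false false false ()

bits-self : ∀ (f : Role → Bool) i → bits (f H) (f A) (f B) i ≡ f i
bits-self f H = refl
bits-self f A = refl
bits-self f B = refl

atLeastTwo-intro : ∀ b₀ b₁ b₂ i i' → ¬ i ≡ i' → bits b₀ b₁ b₂ i ≡ true → bits b₀ b₁ b₂ i' ≡ true →
                   atLeastTwo b₀ b₁ b₂ ≡ true
atLeastTwo-intro _     _     _     H H ne = ⊥-elim (ne refl)
atLeastTwo-intro _     _     _     A A ne = ⊥-elim (ne refl)
atLeastTwo-intro _     _     _     B B ne = ⊥-elim (ne refl)
atLeastTwo-intro true  true  _     H A _ refl refl = refl
atLeastTwo-intro true  true  _     A H _ refl refl = refl
atLeastTwo-intro true  b₁    true  H B _ refl refl with b₁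
... | true = refl
... | false = refl
atLeastTwo-intro true  b₁    true  B H _ refl refl with b₁
... | true = refl
... | false = refl
atLeastTwo-intro b₀    true  true  A B _ refl refl with b₀
... | true = refl
... | false = refl
atLeastTwo-intro b₀    true  true  B A _ refl refl with b₀
... | true = refl
... | false = refl

toRole : ℕ → Role
toRole 0 = H
toRole 1 = A
toRole _ = B

toRole-injective : ∀ {a b} → a < 3 → b < 3 → toRole a ≡ toRole b → a ≡ b
toRole-injective {0} {0} _ _ _ = refl
toRole-injective {1} {1} _ _ _ = refl
toRole-injective {2} {2} _ _ _ = refl
toRole-injective {0} {1} _ _ ()
toRole-injective {0} {2} _ _ ()
toRole-injective {1} {0} _ _ ()
toRole-injective {1} {2} _ _ ()
toRole-injective {2} {0} _ _ ()
toRole-injective {2} {1} _ _ ()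
toRole-injective {suc (suc (suc _))} (s≤s (s≤s (s≤s ())))
toRole-injective {_} {suc (suc (suc _))} _ (s≤s (s≤s (s≤s ())))

-- A bipartite graph with minimum degree 2 and at most three vertices on the
-- side P is a copy of the model graph of some counts N: the small-side
-- vertices are the roles, the others are classified by the roles they see
-- and numbered within their kind.  Hence a layout for N colours G.
module SmallSide {n} (G : Graph n) (P : Fin n → Bool) (bip : IsBipartition G P)
                 (small : cnt P ≤ 3) (deg2 : MinDegreeAtLeast 2 G) where

  large-side : ∀ {x y} → Adj G x y → P x ≡ true → P y ≡ false
  large-side {x} {y} xy px = trans (¬-not (λ e → bip x y xy (sym e))) (cong not px)

  small-side : ∀ {y x} → Adj G y x → P y ≡ false → P x ≡ true
  small-side {y} {x} yx py = trans (¬-not (λ e → bip y x yx (sym e))) (cong not py)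

  role : Fin n → Role
  role x = toRole (rank P x)

  role-injective : ∀ {x x'} → P x ≡ true → P x' ≡ true → role x ≡ role x' → x ≡ x'
  role-injective {x} {x'} px px' e =
    rank-injective P x x' px px' (toRole-injective (≤-trans (rank<cnt P x px) small) (≤-trans (rank<cnt P x' px') small) e)

  Sees : Fin n → Role → Set
  Sees y i = ∃[ x ] (P x ≡ true × role x ≡ i × Adj G y x)

  sees? : ∀ y i → Dec (Sees y i)
  sees? y i = any? (λ x → (P x ≟B true) ×-dec ((role x ≟F i) ×-dec (adj G y x ≟B true)))

  seen : Fin n → Role → Bool
  seen y i = ⌊ sees? y i ⌋

  seen-complete : ∀ {y i} → Sees y i → seen y i ≡ true
  seen-complete {y} {i} s with sees? y i
  ... | yes _ = refl
  ... | no ¬s = ⊥-elim (¬s s)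

  seen-sound : ∀ {y i} → seen y i ≡ true → Sees y i
  seen-sound {y} {i} e with sees? y i
  ... | yes s = s
  ... | no _ = ⊥-elim (true≢false (sym e))

  kind : Fin n → Kind
  kind y = classify (seen y H) (seen y A) (seen y B)

  -- a large-side vertex sees two different roles, so its kind lists exactly
  -- the roles it sees
  member-kind : ∀ {y} → P y ≡ false → ∀ i → member (kind y) i ≡ seen y i
  member-kind {y} py i with 2≤cnt⇒two (adj G y) (≤-trans (deg2 y) (≤-reflexive (count≡cnt (adj G y))))
  ... | x₁ , x₂ , yx₁ , yx₂ , x₁≢x₂ =
    trans (member-classify _ _ _ two i) (bits-self (seen y) i)
    where
    p₁ = small-side yx₁ py
    p₂ = small-side yx₂ py
    two : atLeastTwo (seen y H) (seen y A) (seen y B) ≡ true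
    two = atLeastTwo-intro _ _ _ (role x₁) (role x₂) (λ e → x₁≢x₂ (role-injective p₁ p₂ e))
            (trans (bits-self (seen y) (role x₁)) (seen-complete (x₁ , p₁ , refl , yx₁)))
            (trans (bits-self (seen y) (role x₂)) (seen-complete (x₂ , p₂ , refl , yx₂)))

  isKind : Kind → Fin n → Bool
  isKind τ y = not (P y) ∧ ⌊ kind y ≟F τ ⌋

  N : Kind → ℕ
  N τ = cnt (isKind τ)

  index : Fin n → ℕ
  index y = rank (isKind (kind y)) y

  isKind-self : ∀ {y} → P y ≡ false → isKind (kind y) y ≡ true
  isKind-self {y} py rewrite py with kind y ≟F kind y
  ... | yes _ = refl
  ... | no ne = ⊥-elim (ne refl)

  isKind-sound : ∀ {τ y} → isKind τ y ≡ true → P y ≡ false × kind y ≡ τ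
  isKind-sound {τ} {y} e with P y | kind y ≟F τ
  ... | false | yes k≡τ = refl , k≡τ

  neighbour-valid : ∀ {x y} → P x ≡ true → Adj G x y → Valid N (kind y) (role x) (index y)
  neighbour-valid {x} {y} px xy =
    trans (member-kind py (role x)) (seen-complete (x , px , refl , adj-sym G xy)) ,
    rank<cnt (isKind (kind y)) y (isKind-self py)
    where py = large-side xy px

  item-vertex : ∀ {τ i j} → Valid N τ i j → ∃[ y ] (P y ≡ false × kind y ≡ τ × index y ≡ j)
  item-vertex {τ} (_ , lt) with rank-surjective (isKind τ) _ lt
  ... | y , iy , ry with isKind-sound iy
  ... | py , refl = y , py , refl , ry

  item-injective : ∀ {y y'} → P y ≡ false → P y' ≡ false → (kind y , index y) ≡ (kind y' , index y') → y ≡ y'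
  item-injective {y} {y'} py py' e =
    rank-injective (isKind (kind y)) y y' (isKind-self py)
      (subst (λ τ → isKind τ y' ≡ true) (sym (cong proj₁ e)) (isKind-self py'))
      (trans (cong proj₂ e) (cong (λ τ → rank (isKind τ) y') (sym (cong proj₁ e))))

  seen-neighbour : ∀ {y i} → P y ≡ false → member (kind y) i ≡ true → ∃[ x ] (P x ≡ true × role x ≡ i × Adj G y x)
  seen-neighbour {y} {i} py m = seen-sound (trans (sym (member-kind py i)) m)

  module Colour (L : Layout N) where
    module L = Layout L

    col : Fin n → Fin n → ℕ
    col x y = L.colour (kind y) (role x) (index y)

    colour : Fin n → Fin n → ℕ
    colour u v = if P u then col u v else col v u

    colour-small : ∀ {x} y → P x ≡ true → colour x y ≡ col x y
    colour-small y px rewrite px = refl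

    colour-large : ∀ {y} x → P y ≡ false → colour y x ≡ col x y
    colour-large x py rewrite py = refl

    at-small : ∀ x → P x ≡ true → LocalAt G colour x
    at-small x px = record { symmetric = symm ; positive = pos ; proper = prop ; interval = intv }
      where
      here : ∀ {y} → Adj G x y → colour x y ≡ col x y
      here {y} _ = colour-small y px
      symm : ∀ y → Adj G x y → colour x y ≡ colour y x
      symm y xy = trans (here xy) (sym (colour-large x (large-side xy px)))
      pos : ∀ y → Adj G x y → 1 ≤ colour x y
      pos y xy = subst (1 ≤_) (sym (here xy)) (L.positive (neighbour-valid px xy))
      prop : ∀ y y' → Adj G x y → Adj G x y' → colour x y ≡ colour x y' → y ≡ y'
      prop y y' xy xy' e = item-injective (large-side xy px) (large-side xy' px)
        (L.role-injective (neighbour-valid px xy) (neighbour-valid px xy') (trans (sym (here xy)) (trans e (here xy'))))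
      intv : ∀ y y' k → Adj G x y → Adj G x y' → colour x y ≤ k → k ≤ colour x y' → ∃[ z ] (Adj G x z × colour x z ≡ k)
      intv y y' k xy xy' lo hi
        with L.role-interval (neighbour-valid px xy) (neighbour-valid px xy')
               (subst (_≤ k) (here xy) lo) (subst (k ≤_) (here xy') hi)
      ... | τ , j , v@(m , _) , e with item-vertex v
      ... | z , pz , refl , refl with seen-neighbour pz m
      ... | x' , px' , rx' , zx' with role-injective px' px rx'
      ... | refl = z , adj-sym G zx' , trans (colour-small z px) e

    at-large : ∀ y → P y ≡ false → LocalAt G colour y
    at-large y py = record { symmetric = symm ; positive = pos ; proper = prop ; interval = intv }
      where
      here : ∀ {x} → Adj G y x → colour y x ≡ col x y
      here {x} _ = colour-large x py
      member-role : ∀ {x} → Adj G y x → member (kind y) (role x) ≡ true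
      member-role yx = proj₁ (neighbour-valid (small-side yx py) (adj-sym G yx))
      symm : ∀ x → Adj G y x → colour y x ≡ colour x y
      symm x yx = trans (here yx) (sym (colour-small y (small-side yx py)))
      pos : ∀ x → Adj G y x → 1 ≤ colour y x
      pos x yx = subst (1 ≤_) (sym (here yx)) (L.positive (neighbour-valid (small-side yx py) (adj-sym G yx)))
      prop : ∀ x x' → Adj G y x → Adj G y x' → colour y x ≡ colour y x' → x ≡ x'
      prop x x' yx yx' e = role-injective (small-side yx py) (small-side yx' py)
        (L.kind-injective (member-role yx) (member-role yx') (trans (sym (here yx)) (trans e (here yx'))))
      intv : ∀ x x' k → Adj G y x → Adj G y x' → colour y x ≤ k → k ≤ colour y x' → ∃[ z ] (Adj G y z × colour y z ≡ k)
      intv x x' k yx yx' lo hi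
        with L.kind-interval (member-role yx) (member-role yx') (subst (_≤ k) (here yx) lo) (subst (k ≤_) (here yx') hi)
      ... | i , m , e with seen-neighbour py m
      ... | z , pz , refl , yz = z , yz , trans (here yz) e

    local : Local G colour
    local v with P v in pv
    ... | true  = at-small v pv
    ... | false = at-large v pv

small-part : ∀ {n} (G : Graph n) (P : Fin n → Bool) → IsBipartition G P → cnt P ≤ 3 →
             MinDegreeAtLeast 2 G → ∀ {u v} → Adj G u v → IntervalColorable G
small-part G P bip small deg2 = normalise (Colour.local (layout N))
  where open SmallSide G P bip small deg2

-- The other side of a bipartition, in the form used by BothPartsAtLeast4.
other-side : ∀ {n} → (Fin n → Bool) → Fin n → Bool
other-side s u = if s u then false else true

complement-bipartition : ∀ {n} {G : Graph n} {s : Fin n → Bool} → IsBipartition G s → IsBipartition G (other-side s)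
complement-bipartition {s = s} bip u v uv e = bip u v uv (flip-injective (s u) (s v) e)
  where
  flip-injective : ∀ a b → (if a then false else true) ≡ (if b then false else true) → a ≡ b
  flip-injective true  true  _ = refl
  flip-injective false false _ = refl

fewer-than-4 : ∀ {n} (p : Fin n → Bool) → ¬ 4 ≤ count p → cnt p ≤ 3
fewer-than-4 p ¬4≤ = ≤-pred (subst (λ k → suc k ≤ 4) (count≡cnt p) (≰⇒> ¬4≤))

-- A bipartite G of minimum degree 2 whose vertex-deleted subgraphs are
-- interval colourable is interval colourable as soon as this holds when G is
-- connected with both parts of size ≥ 4: otherwise a part has at most three
-- vertices, or G is disconnected.  (Any edge, here one at vertex zero, serves
-- for the small-part case.)
min-degree-2 : ∀ {m} (G : Graph (suc m)) → Bipartite G → MinDegreeAtLeast 2 G →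
               (∀ v → IntervalColorable (deleteVertex G v)) →
               (Connected G → BothPartsAtLeast4 G → IntervalColorable G) → IntervalColorable G
min-degree-2 G (s , bip) deg2 deletions core
  with 2≤cnt⇒two (adj G zero) (≤-trans (deg2 zero) (≤-reflexive (count≡cnt (adj G zero))))
... | y , _ , 0y , _ , _ with 4 ≤? count s | 4 ≤? count (other-side s)
... | no few | _ = small-part G s bip (fewer-than-4 s few) deg2 0y
... | yes _ | no few =
  small-part G (other-side s) (complement-bipartition {G = G} {s} bip) (fewer-than-4 (other-side s) few) deg2 0y
... | yes many | yes many' with all? (reach? G zero)
...   | yes reach-all = core (λ u v → reach-sym G (reach-all u) ◅◅ reach-all v) (s , bip , many , many')
...   | no ¬reach-all with ¬∀⟶∃¬ _ (Reach G zero) (reach? G zero) ¬reach-all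
...     | w , 0↛w = disconnected G deletions 0↛w

lemma1 : (𝔉 : (n : ℕ) → Graph n → Set)
    → (∀ n (G : Graph n) → 𝔉 n G → Bipartite G)
    → (∀ n (G : Graph n) → 𝔉 n G → 1 ≤ n)
    → (∀ m (G : Graph (suc m)) → 𝔉 (suc m) G → (v : Fin (suc m)) → IntervalColorable (deleteVertex G v))
    → (∀ n (G : Graph n) → 𝔉 n G → Connected G → MinDegreeAtLeast 2 G → BothPartsAtLeast4 G → IntervalColorable G)
    → ∀ n (G : Graph n) → 𝔉 n G → IntervalColorable G
lemma1 𝔉 bipartite nonempty deletions core zero G G∈𝔉 with nonempty zero G G∈𝔉
... | ()
lemma1 𝔉 bipartite nonempty deletions core (suc m) G G∈𝔉 with any? (λ v → degree G v ≤? 1)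
... | yes (v , deg≤1) = low-degree G v deg≤1 (deletions m G G∈𝔉 v)
... | no ¬low = min-degree-2 G (bipartite _ G G∈𝔉) deg2 (deletions m G G∈𝔉) (λ conn → core _ G G∈𝔉 conn deg2)
  where
  deg2 : MinDegreeAtLeast 2 G
  deg2 v = ≰⇒> (λ deg≤1 → ¬low (v , deg≤1))
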